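{- Let $k=6$. For integers $\Delta\ge 2$, the independent set model has uniqueness on $\mathbb{T}_{k,\Delta}$ if and only if $\Delta\le 28$.
   Context: $\mathbb{T}_{k,\Delta}$ is the infinite $(\Delta-1)$-ary $k$-uniform hypertree with root $\rho$: recursively, each vertex has $\Delta-1$ "descending" hyperedges, each consisting of that vertex together with $k-1$ new vertices. Level $0$ is $\{\rho\}$ and the new vertices in descending hyperedges of level-$i$ vertices form level $i+1$. For $n\ge 0$, $\mathbb{T}_{k,\Delta}(n)$ is the sub-hypergraph induced by levels $0,\dots,n$ (vertex set $V_n$), and $L_n$ is the set of level-$n$ vertices. An independent set is a vertex subset containing no hyperedge; identify it with $\sigma:V_n\to\{0,1\}$ ($\sigma(v)=1$ iff $v$ is in the set). $\mu_n$ is the uniform distribution on independent sets of $\mathbb{T}_{k,\Delta}(n)$. The model has uniqueness on $\mathbb{T}_{k,\Delta}$ iff $\limsup_{n\to\infty}\max_{\eta,\eta':L_n\to\{0,1\}}\big|\mu_n(\sigma_\rho=1\mid\sigma_{L_n}=\eta)-\mu_n(\sigma_\rho=1\mid\sigma_{L_n}=\eta')\big|=0$. -}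

module Defs where

open import Data.Nat using (ℕ; zero; suc; _∸_)
open import Data.Bool using (Bool; true; false; _∧_; not; if_then_else_)
open import Data.Product using (_×_; _,_; ∃-syntax)
open import Data.Vec using (Vec; []; _∷_)
import Data.Vec as V
open import Data.List using (List; []; _∷_; concatMap; map)
open import Data.Integer using (+_)
open import Data.Rational using (ℚ; _/_; 0ℚ; _-_; ∣_∣; _≤_; _>_)
import Data.Nat as ℕ

-- Encoding of the (k-uniform, (Δ-1)-ary) hypertree of depth n.
-- Parameters: m = k - 1 (new vertices per descending hyperedge),
--             d = Δ - 1 (descending hyperedges per vertex).
-- A configuration σ : V_n → {0,1} of T(n) is: the spin of the root, and for
-- each of the d descending hyperedges of the root, the configurations of the
-- m depth-(n-1) subtrees hanging from the m new vertices of that hyperedge.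
Config : ℕ → ℕ → ℕ → Set
Config m d zero    = Bool
Config m d (suc n) = Bool × Vec (Vec (Config m d n) m) d

-- Boundary conditions η : L_n → {0,1}, organised along the same tree shape.
Leaves : ℕ → ℕ → ℕ → Set
Leaves m d zero    = Bool
Leaves m d (suc n) = Vec (Vec (Leaves m d n) m) d

rootSpin : ∀ {m d} n → Config m d n → Bool
rootSpin zero    b       = b
rootSpin (suc n) (b , _) = b

allV : ∀ {A : Set} {n} → (A → Bool) → Vec A n → Bool
allV p []       = true
allV p (x ∷ xs) = p x ∧ allV p xs

-- σ is an independent set: no hyperedge has all its vertices occupied.
-- A descending hyperedge of the root = root + the roots of its m subtrees.
independent : ∀ {m d} n → Config m d n → Bool
independent zero    b        = true
independent (suc n) (b , hs) =
  allV (λ e → not (b ∧ allV (rootSpin n) e) ∧ allV (independent n) e) hs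

sequenceV : ∀ {A : Set} {n} → Vec (List A) n → List (Vec A n)
sequenceV []         = [] ∷ []
sequenceV (xs ∷ xss) = concatMap (λ x → map (x ∷_) (sequenceV xss)) xs

compatible : ∀ {m d} n → Leaves m d n → List (Config m d n)
compatible zero    b = b ∷ []
compatible (suc n) η =
  concatMap (λ b → map (b ,_) (sequenceV (V.map (λ row → sequenceV (V.map (compatible n) row)) η)))
            (true ∷ false ∷ [])

countTrue : ∀ {A : Set} → (A → Bool) → List A → ℕ
countTrue p []       = 0
countTrue p (x ∷ xs) = if p x then suc (countTrue p xs) else countTrue p xs

-- a / b as a rational (b = 0 never occurs below since every boundary
-- condition is feasible; the value 0 is then an arbitrary convention).
ratio : ℕ → ℕ → ℚ
ratio a zero    = 0ℚ
ratio a (suc b) = (+ a) / suc b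

Cfg : ℕ → ℕ → ℕ → Set
Cfg k Δ n = Config (k ∸ 1) (Δ ∸ 1) n

Bdry : ℕ → ℕ → ℕ → Set
Bdry k Δ n = Leaves (k ∸ 1) (Δ ∸ 1) n

-- μ_n(σ_ρ = 1 | σ_{L_n} = η) for the uniform distribution on independent sets.
condProb : (k Δ n : ℕ) → Bdry k Δ n → ℚ
condProb k Δ n η =
  ratio (countTrue (λ σ → independent n σ ∧ rootSpin n σ) (compatible n η))
        (countTrue (independent n) (compatible n η))

-- Uniqueness: limsup_n max_{η,η'} |μ_n(ρ=1|η) - μ_n(ρ=1|η')| = 0,
-- i.e. (the sequence being nonnegative) it tends to 0.
Uniqueness : ℕ → ℕ → Set
Uniqueness k Δ =
  (ε : ℚ) → ε > 0ℚ → ∃[ N ] ((n : ℕ) → N ℕ.≤ n → (η η' : Bdry k Δ n) →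
    ∣ condProb k Δ n η - condProb k Δ n η' ∣ ≤ ε)

module Submission where

-- The root marginal obeys the tree recursion p ↦ H p = F p / (1 + F p), F p = (1 - p⁵)^d with
-- d = Δ - 1: if the children of every vertex have marginals in [lo , hi], the vertex has its
-- marginal in [H hi , H lo].  Iterating from [0 , 1] gives nested intervals that contain the root
-- marginal under every boundary condition at depth n, so uniqueness follows once their widths
-- tend to 0.  For Δ ≤ 28, exact dyadic arithmetic shows that after finitely many steps the
-- intervals lie in a region where H contracts by the factor 1 - 1/1024.  For Δ ≥ 29, H has a
-- two-cycle c < b (H b ≤ c and b ≤ H c): with all-occupied or all-vacant leaves at even depth the
-- root marginal stays in [b , 1] or in [0 , c] respectively.  Such pairs are certified exactly for
-- Δ ≤ 90, and for larger Δ one may take b = 43/100 and c = (68/69)^d, by Bernoulli's inequality.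

module Counting where

  open import Data.Bool using (Bool; true; false; _∧_; not)
  open import Data.Bool.Properties using (∧-identityʳ; ∧-zeroʳ)
  open import Data.List using (List; []; _∷_; _++_; map; concatMap)
  open import Data.Nat using (ℕ; zero; suc; _+_; _*_; _∸_; _≤_; z≤n; s≤s)
  open import Data.Nat.Properties
    using (+-comm; +-identityʳ; m+n∸n≡m; ≤-refl; ≤-trans; *-mono-≤; m≤n⇒m≤1+n; m≤n+m)
  open import Data.Product using (_,_)
  open import Data.Vec using (Vec; []; _∷_)
  import Data.Vec as Vec
  open import Data.Vec.Properties using (map-cong)
  open import Relation.Binary.PropositionalEquality
  open ≡-Reasoning

  open import Defs

  product : ∀ {n} → Vec ℕ n → ℕ
  product []       = 1
  product (x ∷ xs) = x * product xs

  module _ {A : Set} where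

    product-mono-≤ : ∀ {n} (f g : A → ℕ) → (∀ x → f x ≤ g x) →
                     (xs : Vec A n) → product (Vec.map f xs) ≤ product (Vec.map g xs)
    product-mono-≤ f g f≤g []       = ≤-refl
    product-mono-≤ f g f≤g (x ∷ xs) = *-mono-≤ (f≤g x) (product-mono-≤ f g f≤g xs)

    product-positive : ∀ {n} (f : A → ℕ) → (∀ x → 1 ≤ f x) → (xs : Vec A n) → 1 ≤ product (Vec.map f xs)
    product-positive f 1≤f []       = ≤-refl
    product-positive f 1≤f (x ∷ xs) = *-mono-≤ (1≤f x) (product-positive f 1≤f xs)

    countTrue-++ : ∀ (p : A → Bool) xs ys → countTrue p (xs ++ ys) ≡ countTrue p xs + countTrue p ys
    countTrue-++ p []       ys = refl
    countTrue-++ p (x ∷ xs) ys with p x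
    ... | true  = cong suc (countTrue-++ p xs ys)
    ... | false = countTrue-++ p xs ys

    countTrue-map : ∀ {B : Set} (p : B → Bool) (f : A → B) xs →
                    countTrue p (map f xs) ≡ countTrue (λ x → p (f x)) xs
    countTrue-map p f []       = refl
    countTrue-map p f (x ∷ xs) with p (f x)
    ... | true  = cong suc (countTrue-map p f xs)
    ... | false = countTrue-map p f xs

    countTrue-cong : ∀ {p q : A → Bool} → (∀ x → p x ≡ q x) → ∀ xs → countTrue p xs ≡ countTrue q xs
    countTrue-cong p≗q []       = refl
    countTrue-cong {p} {q} p≗q (x ∷ xs) rewrite p≗q x with q x
    ... | true  = cong suc (countTrue-cong p≗q xs)
    ... | false = countTrue-cong p≗q xs

    countTrue-false : ∀ (xs : List A) → countTrue (λ _ → false) xs ≡ 0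
    countTrue-false []       = refl
    countTrue-false (x ∷ xs) = countTrue-false xs

    countTrue-∧-≤ : ∀ (p q : A → Bool) xs → countTrue (λ x → p x ∧ q x) xs ≤ countTrue p xs
    countTrue-∧-≤ p q []       = z≤n
    countTrue-∧-≤ p q (x ∷ xs) with p x | q x
    ... | true  | true  = s≤s (countTrue-∧-≤ p q xs)
    ... | true  | false = m≤n⇒m≤1+n (countTrue-∧-≤ p q xs)
    ... | false | _     = countTrue-∧-≤ p q xs

    countTrue-partition : ∀ (p q : A → Bool) xs →
      countTrue (λ x → not (q x) ∧ p x) xs + countTrue (λ x → p x ∧ q x) xs ≡ countTrue p xs
    countTrue-partition p q []       = refl
    countTrue-partition p q (x ∷ xs) with p x | q x
    ... | true  | true  = begin
      countTrue (λ x → not (q x) ∧ p x) xs + suc (countTrue (λ x → p x ∧ q x) xs)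
        ≡⟨ +-comm _ (suc _) ⟩
      suc (countTrue (λ x → p x ∧ q x) xs + countTrue (λ x → not (q x) ∧ p x) xs)
        ≡⟨ cong suc (trans (+-comm (countTrue (λ x → p x ∧ q x) xs) _) (countTrue-partition p q xs)) ⟩
      suc (countTrue p xs) ∎
    ... | true  | false = cong suc (countTrue-partition p q xs)
    ... | false | true  = countTrue-partition p q xs
    ... | false | false = countTrue-partition p q xs

    allV-∧ : ∀ {n} (p q : A → Bool) (xs : Vec A n) → allV p xs ∧ allV q xs ≡ allV (λ x → p x ∧ q x) xs
    allV-∧ p q []       = refl
    allV-∧ p q (x ∷ xs) with p x | q x
    ... | true  | true  = allV-∧ p q xs
    ... | true  | false = ∧-zeroʳ (allV p xs)
    ... | false | _     = refl

  countTrue-allV-sequenceV : ∀ {A B : Set} {n} (p : B → Bool) (f : A → List B) (xs : Vec A n) →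
    countTrue (allV p) (sequenceV (Vec.map f xs)) ≡ product (Vec.map (λ x → countTrue p (f x)) xs)
  countTrue-allV-sequenceV p f []       = refl
  countTrue-allV-sequenceV p f (x ∷ xs) = prepend (f x)
    where
    tails = sequenceV (Vec.map f xs)
    P = product (Vec.map (λ x → countTrue p (f x)) xs)
    prepend : ∀ ys → countTrue (allV p) (concatMap (λ y → map (y ∷_) tails) ys) ≡ countTrue p ys * P
    prepend []       = refl
    prepend (y ∷ ys) = begin
      countTrue (allV p) (map (y ∷_) tails ++ concatMap (λ y → map (y ∷_) tails) ys)
        ≡⟨ countTrue-++ (allV p) (map (y ∷_) tails) _ ⟩
      countTrue (allV p) (map (y ∷_) tails) + countTrue (allV p) (concatMap (λ y → map (y ∷_) tails) ys)
        ≡⟨ cong₂ _+_ (countTrue-map (allV p) (y ∷_) tails) (prepend ys) ⟩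
      countTrue (λ t → p y ∧ allV p t) tails + countTrue p ys * P
        ≡⟨ by-first y ⟩
      countTrue p (y ∷ ys) * P ∎
      where
      by-first : ∀ y → countTrue (λ t → p y ∧ allV p t) tails + countTrue p ys * P ≡ countTrue p (y ∷ ys) * P
      by-first y with p y
      ... | true  = cong (_+ countTrue p ys * P) (countTrue-allV-sequenceV p f xs)
      ... | false = cong (_+ countTrue p ys * P) (countTrue-false tails)

  module PartitionFunctions (m d : ℕ) where

    Z : ∀ n → Leaves m d n → ℕ
    Z n η = countTrue (independent n) (compatible n η)

    Z⁺ : ∀ n → Leaves m d n → ℕ
    Z⁺ n η = countTrue (λ σ → independent n σ ∧ rootSpin n σ) (compatible n η)

    Z⁺≤Z : ∀ n η → Z⁺ n η ≤ Z n η
    Z⁺≤Z n η = countTrue-∧-≤ (independent n) (rootSpin n) (compatible n η)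

    childrenZ childrenZ⁺ : ∀ n → Vec (Leaves m d n) m → ℕ
    childrenZ  n row = product (Vec.map (Z n) row)
    childrenZ⁺ n row = product (Vec.map (Z⁺ n) row)

    childrenZ⁺≤childrenZ : ∀ n row → childrenZ⁺ n row ≤ childrenZ n row
    childrenZ⁺≤childrenZ n = product-mono-≤ (Z⁺ n) (Z n) (Z⁺≤Z n)

    module _ (n : ℕ) where

      rowConfigs : Vec (Leaves m d n) m → List (Vec (Config m d n) m)
      rowConfigs row = sequenceV (Vec.map (compatible n) row)

      subtreeConfigs : Leaves m d (suc n) → List (Vec (Vec (Config m d n) m) d)
      subtreeConfigs η = sequenceV (Vec.map rowConfigs η)

      countTrue-compatible-suc : ∀ (p : Config m d (suc n) → Bool) η →
        countTrue p (compatible (suc n) η)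
          ≡ countTrue (λ s → p (true , s)) (subtreeConfigs η) + countTrue (λ s → p (false , s)) (subtreeConfigs η)
      countTrue-compatible-suc p η = begin
        countTrue p (map (true ,_) S ++ map (false ,_) S ++ [])
          ≡⟨ countTrue-++ p (map (true ,_) S) _ ⟩
        countTrue p (map (true ,_) S) + countTrue p (map (false ,_) S ++ [])
          ≡⟨ cong (countTrue p (map (true ,_) S) +_) (trans (countTrue-++ p (map (false ,_) S) []) (+-identityʳ _)) ⟩
        countTrue p (map (true ,_) S) + countTrue p (map (false ,_) S)
          ≡⟨ cong₂ _+_ (countTrue-map p (true ,_) S) (countTrue-map p (false ,_) S) ⟩
        countTrue (λ s → p (true , s)) S + countTrue (λ s → p (false , s)) S ∎
        where S = subtreeConfigs η

      countTrue-free-edge : ∀ row → countTrue (allV (independent n)) (rowConfigs row) ≡ childrenZ n row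
      countTrue-free-edge = countTrue-allV-sequenceV (independent n) (compatible n)

      countTrue-full-edge : ∀ row →
        countTrue (λ e → allV (independent n) e ∧ allV (rootSpin n) e) (rowConfigs row) ≡ childrenZ⁺ n row
      countTrue-full-edge row = trans
        (countTrue-cong (allV-∧ (independent n) (rootSpin n)) (rowConfigs row))
        (countTrue-allV-sequenceV (λ σ → independent n σ ∧ rootSpin n σ) (compatible n) row)

      -- An occupied root forbids exactly the edges whose children are all occupied.
      countTrue-allowed-edge : ∀ row →
        countTrue (λ e → not (allV (rootSpin n) e) ∧ allV (independent n) e) (rowConfigs row)
          ≡ childrenZ n row ∸ childrenZ⁺ n row
      countTrue-allowed-edge row = begin
        allowed                   ≡⟨ m+n∸n≡m allowed full ⟨
        allowed + full ∸ full     ≡⟨ cong₂ _∸_ (trans (countTrue-partition (allV (independent n)) (allV (rootSpin n)) S)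
                                                      (countTrue-free-edge row))
                                               (countTrue-full-edge row) ⟩
        childrenZ n row ∸ childrenZ⁺ n row ∎
        where
        S = rowConfigs row
        allowed = countTrue (λ e → not (allV (rootSpin n) e) ∧ allV (independent n) e) S
        full = countTrue (λ e → allV (independent n) e ∧ allV (rootSpin n) e) S

      Z⁺-suc-root-occupied : ∀ η → Z⁺ (suc n) η ≡ countTrue (λ s → independent (suc n) (true , s)) (subtreeConfigs η)
      Z⁺-suc-root-occupied η = begin
        Z⁺ (suc n) η
          ≡⟨ countTrue-compatible-suc (λ σ → independent (suc n) σ ∧ rootSpin (suc n) σ) η ⟩
        countTrue (λ s → independent (suc n) (true , s) ∧ true) S
          + countTrue (λ s → independent (suc n) (false , s) ∧ false) S
          ≡⟨ cong₂ _+_ (countTrue-cong (λ s → ∧-identityʳ _) S)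
                       (trans (countTrue-cong (λ s → ∧-zeroʳ _) S) (countTrue-false S)) ⟩
        countTrue (λ s → independent (suc n) (true , s)) S + 0
          ≡⟨ +-identityʳ _ ⟩
        countTrue (λ s → independent (suc n) (true , s)) S ∎
        where S = subtreeConfigs η

      Z⁺-suc : ∀ η → Z⁺ (suc n) η ≡ product (Vec.map (λ row → childrenZ n row ∸ childrenZ⁺ n row) η)
      Z⁺-suc η = begin
        Z⁺ (suc n) η
          ≡⟨ Z⁺-suc-root-occupied η ⟩
        countTrue (allV (λ e → not (allV (rootSpin n) e) ∧ allV (independent n) e)) (subtreeConfigs η)
          ≡⟨ countTrue-allV-sequenceV _ rowConfigs η ⟩
        product (Vec.map (λ row → countTrue (λ e → not (allV (rootSpin n) e) ∧ allV (independent n) e)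
                                            (rowConfigs row)) η)
          ≡⟨ cong product (map-cong countTrue-allowed-edge η) ⟩
        product (Vec.map (λ row → childrenZ n row ∸ childrenZ⁺ n row) η) ∎

      Z-suc : ∀ η → Z (suc n) η ≡ Z⁺ (suc n) η + product (Vec.map (childrenZ n) η)
      Z-suc η = begin
        Z (suc n) η
          ≡⟨ countTrue-compatible-suc (independent (suc n)) η ⟩
        countTrue (λ s → independent (suc n) (true , s)) S + countTrue (allV (allV (independent n))) S
          ≡⟨ cong₂ _+_ (sym (Z⁺-suc-root-occupied η)) (countTrue-allV-sequenceV _ rowConfigs η) ⟩
        Z⁺ (suc n) η + product (Vec.map (λ row → countTrue (allV (independent n)) (rowConfigs row)) η)
          ≡⟨ cong (λ z → Z⁺ (suc n) η + product z) (map-cong countTrue-free-edge η) ⟩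
        Z⁺ (suc n) η + product (Vec.map (childrenZ n) η) ∎
        where S = subtreeConfigs η

    Z-positive : ∀ n η → 1 ≤ Z n η
    Z-positive zero    η = ≤-refl
    Z-positive (suc n) η = subst (1 ≤_) (sym (Z-suc n η))
      (≤-trans (product-positive (childrenZ n) (λ row → product-positive (Z n) (Z-positive n) row) η)
               (m≤n+m _ (Z⁺ (suc n) η)))

module RootMarginal where

  open Counting

  open import Algebra.Bundles using (CommutativeRing)
  open import Data.Bool using (Bool; true; false; not; T; _∧_)
  open import Data.Bool.Properties using (T-∧; T-not-≡)
  open import Data.Empty using (⊥-elim)
  open import Data.Integer as ℤ using (+_; +0; +[1+_]; -[1+_])
  import Data.Integer.Properties as ℤ
  open import Data.List using (List; []; _∷_; length)
  import Data.List as List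
  open import Data.Nat as ℕ using (ℕ; zero; suc; _∸_)
  import Data.Nat.Properties as ℕ
  open import Data.Product using (_×_; _,_; proj₁; proj₂; ∃-syntax)
  open import Data.Rational
  open import Data.Rational.Literals using (fromℤ)
  open import Data.Rational.Properties
  open import Data.Rational.Solver using (module +-*-Solver)
  import Data.Rational.Unnormalised as ℚᵘ
  import Data.Rational.Unnormalised.Properties as ℚᵘ
  open import Data.Sum using (inj₁; inj₂)
  open import Data.Unit using (tt)
  open import Function using (_∘′_; Equivalence)
  open import Data.Vec using (Vec; []; _∷_; replicate)
  import Data.Vec as Vec
  open import Data.Vec.Relation.Unary.All using (All; []; _∷_)
  import Data.Vec.Relation.Unary.All as All
  open import Relation.Binary.PropositionalEquality
  open import Relation.Nullary using (¬_; yes; no)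
  open import Relation.Nullary.Decidable using (toWitness)

  open import Algebra.Properties.Semiring.Exp (CommutativeRing.semiring +-*-commutativeRing)
    using (_^_; ^-homo-*; ^-assocʳ)
  open import Algebra.Properties.Semiring.Exp (CommutativeRing.semiring ℚᵘ.+-*-commutativeRing)
    using () renaming (_^_ to _^ᵘ_)
  open +-*-Solver

  open import Defs

  -- Rational arithmetic

  fromℕ : ℕ → ℚ
  fromℕ n = fromℤ (+ n)

  fromℕ-+ : ∀ a b → fromℕ (a ℕ.+ b) ≡ fromℕ a + fromℕ b
  fromℕ-+ a b = toℚᵘ-injective (ℚᵘ.≃-trans (ℚᵘ.*≡* eq) (ℚᵘ.≃-sym (toℚᵘ-homo-+ (fromℕ a) (fromℕ b))))
    where
    eq : + (a ℕ.+ b) ℤ.* + 1 ≡ (+ a ℤ.* + 1 ℤ.+ + b ℤ.* + 1) ℤ.* + 1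
    eq rewrite ℤ.*-identityʳ (+ a) | ℤ.*-identityʳ (+ b) | ℤ.*-identityʳ (+ a ℤ.+ + b) = ℤ.pos-+ a b

  fromℕ-* : ∀ a b → fromℕ (a ℕ.* b) ≡ fromℕ a * fromℕ b
  fromℕ-* a b = toℚᵘ-injective (ℚᵘ.≃-trans (ℚᵘ.*≡* eq) (ℚᵘ.≃-sym (toℚᵘ-homo-* (fromℕ a) (fromℕ b))))
    where
    eq : + (a ℕ.* b) ℤ.* + 1 ≡ (+ a ℤ.* + b) ℤ.* + 1
    eq rewrite ℤ.*-identityʳ (+ a ℤ.* + b) | ℤ.*-identityʳ (+ (a ℕ.* b)) = ℤ.pos-* a b

  fromℕ-mono-≤ : ∀ {a b} → a ℕ.≤ b → fromℕ a ≤ fromℕ b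
  fromℕ-mono-≤ {a} {b} a≤b = *≤* (subst₂ ℤ._≤_ (sym (ℤ.*-identityʳ (+ a))) (sym (ℤ.*-identityʳ (+ b))) (ℤ.+≤+ a≤b))

  fromℕ-nonNeg : ∀ a → 0ℚ ≤ fromℕ a
  fromℕ-nonNeg a = fromℕ-mono-≤ ℕ.z≤n

  fromℕ-∸ : ∀ {a b} → b ℕ.≤ a → fromℕ (a ∸ b) ≡ fromℕ a - fromℕ b
  fromℕ-∸ {a} {b} b≤a = begin
    fromℕ (a ∸ b)                 ≡⟨ solve 2 (λ x y → x := (x :+ y) :- y) refl (fromℕ (a ∸ b)) (fromℕ b) ⟩
    (fromℕ (a ∸ b) + fromℕ b) - fromℕ b
      ≡⟨ cong (_- fromℕ b) (trans (sym (fromℕ-+ (a ∸ b) b)) (cong fromℕ (ℕ.m∸n+n≡m b≤a))) ⟩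
    fromℕ a - fromℕ b             ∎
    where open ≡-Reasoning

  /-*-denominator : ∀ a b → (+ a / suc b) * fromℕ (suc b) ≡ fromℕ a
  /-*-denominator a b = toℚᵘ-injective (ℚᵘ.≃-trans (toℚᵘ-homo-* (+ a / suc b) (fromℕ (suc b)))
                          (ℚᵘ.≃-trans (ℚᵘ.*-congʳ (toℚᵘ-fromℚᵘ (ℚᵘ.mkℚᵘ (+ a) b))) (ℚᵘ.*≡* eq)))
    where
    eq : (+ a ℤ.* + suc b) ℤ.* + 1 ≡ + a ℤ.* (+ suc (b ℕ.* 1))
    eq rewrite ℤ.*-identityʳ (+ a ℤ.* + suc b) | ℕ.*-identityʳ b = refl

  0≤1 : 0ℚ ≤ 1ℚ
  0≤1 = ≤ᵇ⇒≤ tt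

  0<1 : 0ℚ < 1ℚ
  0<1 = positive⁻¹ 1ℚ

  fromℕ-pos : ∀ a → 0ℚ < fromℕ (suc a)
  fromℕ-pos a = <-≤-trans 0<1 (fromℕ-mono-≤ (ℕ.s≤s ℕ.z≤n))

  archimedean : ∀ ε → 0ℚ < ε → ∃[ s ] (1ℚ ≤ fromℕ s * ε)
  archimedean ε@(mkℚ +[1+ a ] b _) _ = suc b , subst (1ℚ ≤_) (sym ε-scaled) (fromℕ-mono-≤ (ℕ.s≤s ℕ.z≤n))
    where
    eq : (+ suc a ℤ.* + suc b) ℤ.* + 1 ≡ + suc a ℤ.* (+ suc (b ℕ.* 1))
    eq rewrite ℤ.*-identityʳ (+ suc a ℤ.* + suc b) | ℕ.*-identityʳ b = refl
    ε-scaled : fromℕ (suc b) * ε ≡ fromℕ (suc a)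
    ε-scaled = trans (*-comm (fromℕ (suc b)) ε)
      (toℚᵘ-injective (ℚᵘ.≃-trans (toℚᵘ-homo-* ε (fromℕ (suc b))) (ℚᵘ.*≡* eq)))
  archimedean ε@(mkℚ +0 _ _) 0<ε = ⊥-elim (<-irrefl (sym (↥p≡0⇒p≡0 ε refl)) 0<ε)
  archimedean (mkℚ -[1+ _ ] _ _) (*<* ())

  *-monoˡ-≤ : ∀ {p q r} → 0ℚ ≤ r → p ≤ q → r * p ≤ r * q
  *-monoˡ-≤ {r = r} 0≤r = *-monoˡ-≤-nonNeg r {{nonNegative 0≤r}}

  *-monoʳ-≤ : ∀ {p q r} → 0ℚ ≤ r → p ≤ q → p * r ≤ q * r
  *-monoʳ-≤ {r = r} 0≤r = *-monoʳ-≤-nonNeg r {{nonNegative 0≤r}}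

  *-mono-≤ : ∀ {p q r s} → 0ℚ ≤ p → 0ℚ ≤ r → p ≤ q → r ≤ s → p * r ≤ q * s
  *-mono-≤ 0≤p 0≤r p≤q r≤s = ≤-trans (*-monoʳ-≤ 0≤r p≤q) (*-monoˡ-≤ (≤-trans 0≤p p≤q) r≤s)

  *-nonNeg : ∀ {p q} → 0ℚ ≤ p → 0ℚ ≤ q → 0ℚ ≤ p * q
  *-nonNeg {p} {q} 0≤p 0≤q = subst (_≤ p * q) (*-zeroˡ q) (*-monoʳ-≤ 0≤q 0≤p)

  *-pos : ∀ {p q} → 0ℚ < p → 0ℚ < q → 0ℚ < p * q
  *-pos {p} {q} 0<p 0<q = positive⁻¹ (p * q) {{pos*pos⇒pos p {{positive 0<p}} q {{positive 0<q}}}}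

  *-cancelʳ-≤ : ∀ {p q r} → 0ℚ < r → p * r ≤ q * r → p ≤ q
  *-cancelʳ-≤ {r = r} 0<r = *-cancelʳ-≤-pos r {{positive 0<r}}

  *-swapʳ : ∀ p q r → (p * q) * r ≡ (p * r) * q
  *-swapʳ = solve 3 (λ p q r → (p :* q) :* r := (p :* r) :* q) refl

  *-interchange : ∀ p q r s → (p * q) * (r * s) ≡ (p * r) * (q * s)
  *-interchange = solve 4 (λ p q r s → (p :* q) :* (r :* s) := (p :* r) :* (q :* s)) refl

  p≤q⇒0≤q-p : ∀ {p q} → p ≤ q → 0ℚ ≤ q - p
  p≤q⇒0≤q-p {p} {q} p≤q = subst (_≤ q - p) (+-inverseʳ p) (+-monoˡ-≤ (- p) p≤q)

  r-q≤r-p : ∀ {p q} r → p ≤ q → r - q ≤ r - p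
  r-q≤r-p r p≤q = +-monoʳ-≤ r (neg-antimono-≤ p≤q)

  ^-nonNeg : ∀ {x} n → 0ℚ ≤ x → 0ℚ ≤ x ^ n
  ^-nonNeg zero    0≤x = 0≤1
  ^-nonNeg (suc n) 0≤x = *-nonNeg 0≤x (^-nonNeg n 0≤x)

  ^-mono-≤ : ∀ {x y} n → 0ℚ ≤ x → x ≤ y → x ^ n ≤ y ^ n
  ^-mono-≤ zero    0≤x x≤y = ≤-refl
  ^-mono-≤ (suc n) 0≤x x≤y = *-mono-≤ 0≤x (^-nonNeg n 0≤x) x≤y (^-mono-≤ n 0≤x x≤y)

  ^-≤1 : ∀ {x} n → 0ℚ ≤ x → x ≤ 1ℚ → x ^ n ≤ 1ℚ
  ^-≤1 zero    0≤x x≤1 = ≤-refl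
  ^-≤1 {x} (suc n) 0≤x x≤1 = subst (x ^ suc n ≤_) (*-identityˡ 1ℚ) (*-mono-≤ 0≤x (^-nonNeg n 0≤x) x≤1 (^-≤1 n 0≤x x≤1))

  0≤1-x^n : ∀ {x} n → 0ℚ ≤ x → x ≤ 1ℚ → 0ℚ ≤ 1ℚ - x ^ n
  0≤1-x^n n 0≤x x≤1 = p≤q⇒0≤q-p (^-≤1 n 0≤x x≤1)

  [1-δ]^k*[1+kδ]≤1 : ∀ {δ} k → 0ℚ ≤ δ → δ ≤ 1ℚ → (1ℚ - δ) ^ k * (1ℚ + fromℕ k * δ) ≤ 1ℚ
  [1-δ]^k*[1+kδ]≤1 {δ} zero    0≤δ δ≤1 =
    ≤-reflexive (solve 1 (λ δ → con 1ℚ :* (con 1ℚ :+ con 0ℚ :* δ) := con 1ℚ) refl δ)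
  [1-δ]^k*[1+kδ]≤1 {δ} (suc k) 0≤δ δ≤1 = begin
    ((1ℚ - δ) * P) * (1ℚ + fromℕ (suc k) * δ)
      ≡⟨ cong (λ z → ((1ℚ - δ) * P) * (1ℚ + z * δ)) (fromℕ-+ 1 k) ⟩
    ((1ℚ - δ) * P) * (1ℚ + (1ℚ + fromℕ k) * δ)
      ≡⟨ solve 3 (λ p x e → ((con 1ℚ :- e) :* p) :* (con 1ℚ :+ (con 1ℚ :+ x) :* e)
                           := p :* (con 1ℚ :+ x :* e) :- p :* ((x :+ con 1ℚ) :* (e :* e))) refl P (fromℕ k) δ ⟩
    P * (1ℚ + fromℕ k * δ) - P * ((fromℕ k + 1ℚ) * (δ * δ))
      ≤⟨ r-q≤r-p (P * (1ℚ + fromℕ k * δ))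
           (*-nonNeg (^-nonNeg k (p≤q⇒0≤q-p δ≤1)) (*-nonNeg (+-mono-≤ (fromℕ-nonNeg k) 0≤1) (*-nonNeg 0≤δ 0≤δ))) ⟩
    P * (1ℚ + fromℕ k * δ) - 0ℚ
      ≡⟨ solve 1 (λ x → x :- con 0ℚ := x) refl (P * (1ℚ + fromℕ k * δ)) ⟩
    P * (1ℚ + fromℕ k * δ)
      ≤⟨ [1-δ]^k*[1+kδ]≤1 k 0≤δ δ≤1 ⟩
    1ℚ ∎
    where
    open ≤-Reasoning
    P = (1ℚ - δ) ^ k

  bernoulli : ∀ {x} n → 0ℚ ≤ x → x ≤ 1ℚ → 1ℚ - fromℕ n * x ≤ (1ℚ - x) ^ n
  bernoulli {x} zero    0≤x x≤1 = ≤-reflexive (solve 1 (λ x → con 1ℚ :- con 0ℚ :* x := con 1ℚ) refl x)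
  bernoulli {x} (suc n) 0≤x x≤1 = begin
    1ℚ - fromℕ (suc n) * x
      ≡⟨ cong (λ z → 1ℚ - z * x) (fromℕ-+ 1 n) ⟩
    1ℚ - (1ℚ + fromℕ n) * x
      ≡⟨ solve 2 (λ k x → con 1ℚ :- (con 1ℚ :+ k) :* x := (con 1ℚ :- x) :* (con 1ℚ :- k :* x) :- k :* (x :* x))
                 refl (fromℕ n) x ⟩
    A - fromℕ n * (x * x)
      ≤⟨ r-q≤r-p A (*-nonNeg (fromℕ-nonNeg n) (*-nonNeg 0≤x 0≤x)) ⟩
    A - 0ℚ
      ≡⟨ solve 1 (λ a → a :- con 0ℚ := a) refl A ⟩
    (1ℚ - x) * (1ℚ - fromℕ n * x)
      ≤⟨ *-monoˡ-≤ (p≤q⇒0≤q-p x≤1) (bernoulli n 0≤x x≤1) ⟩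
    (1ℚ - x) * (1ℚ - x) ^ n ∎
    where
    open ≤-Reasoning
    A = (1ℚ - x) * (1ℚ - fromℕ n * x)

  [1-1/[1+t]]^k→0 : ∀ t ε → 0ℚ < ε → ∃[ k ] ((1ℚ - + 1 / suc t) ^ k ≤ ε)
  [1-1/[1+t]]^k→0 t ε 0<ε with archimedean ε 0<ε
  ... | s , 1≤s*ε = suc t ℕ.* s , (begin
    P                   ≡⟨ *-identityʳ P ⟨
    P * 1ℚ              ≤⟨ *-monoˡ-≤ 0≤P 1≤s*ε ⟩
    P * (fromℕ s * ε)   ≡⟨ *-assoc P (fromℕ s) ε ⟨
    (P * fromℕ s) * ε   ≤⟨ *-monoʳ-≤ (<⇒≤ 0<ε) P*s≤1 ⟩
    1ℚ * ε              ≡⟨ *-identityˡ ε ⟩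
    ε                   ∎)
    where
    open ≤-Reasoning
    δ = + 1 / suc t
    0≤δ : 0ℚ ≤ δ
    0≤δ = *-cancelʳ-≤ (fromℕ-pos t)
      (subst₂ _≤_ (sym (*-zeroˡ (fromℕ (suc t)))) (sym (/-*-denominator 1 t)) (fromℕ-nonNeg 1))
    δ≤1 : δ ≤ 1ℚ
    δ≤1 = *-cancelʳ-≤ (fromℕ-pos t)
      (subst₂ _≤_ (sym (/-*-denominator 1 t)) (sym (*-identityˡ (fromℕ (suc t)))) (fromℕ-mono-≤ (ℕ.s≤s ℕ.z≤n)))
    P = (1ℚ - δ) ^ (suc t ℕ.* s)
    0≤P = ^-nonNeg (suc t ℕ.* s) (p≤q⇒0≤q-p δ≤1)
    kδ≡s : fromℕ (suc t ℕ.* s) * δ ≡ fromℕ s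
    kδ≡s = begin-equality
      fromℕ (suc t ℕ.* s) * δ
        ≡⟨ cong (_* δ) (fromℕ-* (suc t) s) ⟩
      fromℕ (suc t) * fromℕ s * δ
        ≡⟨ solve 3 (λ a b c → a :* b :* c := (c :* a) :* b) refl (fromℕ (suc t)) (fromℕ s) δ ⟩
      (δ * fromℕ (suc t)) * fromℕ s
        ≡⟨ cong (_* fromℕ s) (/-*-denominator 1 t) ⟩
      1ℚ * fromℕ s
        ≡⟨ *-identityˡ (fromℕ s) ⟩
      fromℕ s ∎
    P*s≤1 : P * fromℕ s ≤ 1ℚ
    P*s≤1 = ≤-trans (*-monoˡ-≤ 0≤P (subst (_≤ 1ℚ + fromℕ (suc t ℕ.* s) * δ) (+-identityˡ _)
                       (subst (λ z → 0ℚ + fromℕ s ≤ 1ℚ + z) (sym kδ≡s) (+-monoˡ-≤ (fromℕ s) 0≤1))))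
                    ([1-δ]^k*[1+kδ]≤1 (suc t ℕ.* s) 0≤δ δ≤1)

  x^n-y^n≤n*x^[n-1]*[x-y] : ∀ n {x y} → 0ℚ ≤ y → y ≤ x → x ^ n - y ^ n ≤ fromℕ n * x ^ (n ∸ 1) * (x - y)
  x^n-y^n≤n*x^[n-1]*[x-y] zero {x} {y} _ _ =
    ≤-reflexive (solve 2 (λ x y → con 1ℚ :- con 1ℚ := con 0ℚ :* con 1ℚ :* (x :- y)) refl x y)
  x^n-y^n≤n*x^[n-1]*[x-y] (suc zero) {x} {y} _ _ =
    ≤-reflexive (solve 2 (λ x y → x :* con 1ℚ :- y :* con 1ℚ := con 1ℚ :* con 1ℚ :* (x :- y)) refl x y)
  x^n-y^n≤n*x^[n-1]*[x-y] (suc (suc n)) {x} {y} 0≤y y≤x = begin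
    x * x ^ suc n - y * y ^ suc n
      ≡⟨ solve 4 (λ x y a b → x :* a :- y :* b := x :* (a :- b) :+ (x :- y) :* b) refl x y (x ^ suc n) (y ^ suc n) ⟩
    x * (x ^ suc n - y ^ suc n) + (x - y) * y ^ suc n
      ≤⟨ +-mono-≤ (*-monoˡ-≤ 0≤x (x^n-y^n≤n*x^[n-1]*[x-y] (suc n) 0≤y y≤x))
                  (*-monoˡ-≤ (p≤q⇒0≤q-p y≤x) (^-mono-≤ (suc n) 0≤y y≤x)) ⟩
    x * (fromℕ (suc n) * x ^ n * (x - y)) + (x - y) * x ^ suc n
      ≡⟨ solve 4 (λ x k a e → x :* (k :* a :* e) :+ e :* (x :* a) := (con 1ℚ :+ k) :* (x :* a) :* e)
                 refl x (fromℕ (suc n)) (x ^ n) (x - y) ⟩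
    (1ℚ + fromℕ (suc n)) * x ^ suc n * (x - y)
      ≡⟨ cong (λ z → z * x ^ suc n * (x - y)) (fromℕ-+ 1 (suc n)) ⟨
    fromℕ (suc (suc n)) * x ^ suc n * (x - y) ∎
    where
    open ≤-Reasoning
    0≤x = ≤-trans 0≤y y≤x

  *-mono₃-≤ : ∀ {a b c d e f} → 0ℚ ≤ a → 0ℚ ≤ c → 0ℚ ≤ e → a ≤ b → c ≤ d → e ≤ f → a * c * e ≤ b * d * f
  *-mono₃-≤ 0≤a 0≤c 0≤e a≤b c≤d e≤f = *-mono-≤ (*-nonNeg 0≤a 0≤c) 0≤e (*-mono-≤ 0≤a 0≤c a≤b c≤d) e≤f

  -- 1/⁺ p = 1/p for p > 0, and 0 otherwise; it is only applied to positive arguments.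
  1/⁺ : ℚ → ℚ
  1/⁺ p@(mkℚ +[1+ _ ] _ _) = 1/ p
  1/⁺ _                    = 0ℚ

  *-1/⁺ : ∀ p → 0ℚ < p → p * 1/⁺ p ≡ 1ℚ
  *-1/⁺ p@(mkℚ +[1+ _ ] _ _) _   = *-inverseʳ p
  *-1/⁺ p@(mkℚ +0 _ _)       0<p = ⊥-elim (<-irrefl (sym (↥p≡0⇒p≡0 p refl)) 0<p)
  *-1/⁺ (mkℚ -[1+ _ ] _ _)   (*<* ())

  -- If the children of a vertex are occupied independently with probability x, each of its d
  -- descending edges is unblocked with probability 1 - x^m, so the vertex is occupied with
  -- probability H x, where F x is the odds of being occupied.
  F : ℕ → ℕ → ℚ → ℚ
  F m d x = (1ℚ - x ^ m) ^ d

  H : ℕ → ℕ → ℚ → ℚ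
  H m d x = F m d x * 1/⁺ (1ℚ + F m d x)

  module _ (m d : ℕ) where

    F-nonNeg : ∀ {x} → 0ℚ ≤ x → x ≤ 1ℚ → 0ℚ ≤ F m d x
    F-nonNeg 0≤x x≤1 = ^-nonNeg d (0≤1-x^n m 0≤x x≤1)

    F-antitone : ∀ {x y} → 0ℚ ≤ x → x ≤ y → y ≤ 1ℚ → F m d y ≤ F m d x
    F-antitone 0≤x x≤y y≤1 =
      ^-mono-≤ d (0≤1-x^n m (≤-trans 0≤x x≤y) y≤1) (r-q≤r-p 1ℚ (^-mono-≤ m 0≤x x≤y))

    0<1+F : ∀ {x} → 0ℚ ≤ x → x ≤ 1ℚ → 0ℚ < 1ℚ + F m d x
    0<1+F {x} 0≤x x≤1 = <-≤-trans 0<1 (subst (_≤ 1ℚ + F m d x) (+-identityʳ 1ℚ) (+-monoʳ-≤ 1ℚ (F-nonNeg 0≤x x≤1)))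

    H*[1+F]≡F : ∀ {x} → 0ℚ ≤ x → x ≤ 1ℚ → H m d x * (1ℚ + F m d x) ≡ F m d x
    H*[1+F]≡F {x} 0≤x x≤1 = begin
      (f * 1/⁺ (1ℚ + f)) * (1ℚ + f) ≡⟨ *-assoc f _ _ ⟩
      f * (1/⁺ (1ℚ + f) * (1ℚ + f)) ≡⟨ cong (f *_) (trans (*-comm _ (1ℚ + f)) (*-1/⁺ (1ℚ + f) (0<1+F 0≤x x≤1))) ⟩
      f * 1ℚ                        ≡⟨ *-identityʳ f ⟩
      f                             ∎
      where
      open ≡-Reasoning
      f = F m d x

    y*[1+F]≤F⇒y≤H : ∀ {x y} → 0ℚ ≤ x → x ≤ 1ℚ → y * (1ℚ + F m d x) ≤ F m d x → y ≤ H m d x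
    y*[1+F]≤F⇒y≤H {x} {y} 0≤x x≤1 ≤F =
      *-cancelʳ-≤ (0<1+F 0≤x x≤1) (subst (y * (1ℚ + F m d x) ≤_) (sym (H*[1+F]≡F 0≤x x≤1)) ≤F)

    F≤y*[1+F]⇒H≤y : ∀ {x y} → 0ℚ ≤ x → x ≤ 1ℚ → F m d x ≤ y * (1ℚ + F m d x) → H m d x ≤ y
    F≤y*[1+F]⇒H≤y {x} {y} 0≤x x≤1 F≤ =
      *-cancelʳ-≤ (0<1+F 0≤x x≤1) (subst (_≤ y * (1ℚ + F m d x)) (sym (H*[1+F]≡F 0≤x x≤1)) F≤)

    H-nonNeg : ∀ {x} → 0ℚ ≤ x → x ≤ 1ℚ → 0ℚ ≤ H m d x
    H-nonNeg {x} 0≤x x≤1 =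
      y*[1+F]≤F⇒y≤H 0≤x x≤1 (subst (_≤ F m d x) (sym (*-zeroˡ (1ℚ + F m d x))) (F-nonNeg 0≤x x≤1))

    H-≤1 : ∀ {x} → 0ℚ ≤ x → x ≤ 1ℚ → H m d x ≤ 1ℚ
    H-≤1 {x} 0≤x x≤1 = F≤y*[1+F]⇒H≤y 0≤x x≤1 (subst (F m d x ≤_) (sym (*-identityˡ _))
      (subst (_≤ 1ℚ + F m d x) (+-identityˡ _) (+-monoˡ-≤ (F m d x) 0≤1)))

    H-antitone : ∀ {x y} → 0ℚ ≤ x → x ≤ y → y ≤ 1ℚ → H m d y ≤ H m d x
    H-antitone {x} {y} 0≤x x≤y y≤1 = y*[1+F]≤F⇒y≤H 0≤x (≤-trans x≤y y≤1) (begin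
      Hy * (1ℚ + Fx)                     ≡⟨ regroup ⟩
      Fx - (1ℚ - Hy) * (Fx - Fy)          ≤⟨ r-q≤r-p Fx (*-nonNeg (p≤q⇒0≤q-p (H-≤1 0≤y y≤1))
                                                                (p≤q⇒0≤q-p (F-antitone 0≤x x≤y y≤1))) ⟩
      Fx - 0ℚ                            ≡⟨ solve 1 (λ a → a :- con 0ℚ := a) refl Fx ⟩
      Fx                                 ∎)
      where
      open ≤-Reasoning
      0≤y = ≤-trans 0≤x x≤y
      Fx = F m d x
      Fy = F m d y
      Hy = H m d y
      regroup : Hy * (1ℚ + Fx) ≡ Fx - (1ℚ - Hy) * (Fx - Fy)
      regroup = begin-equality
        Hy * (1ℚ + Fx)
          ≡⟨ solve 3 (λ h a b → h :* (con 1ℚ :+ a) := (a :- (con 1ℚ :- h) :* (a :- b)) :+ (h :* (con 1ℚ :+ b) :- b))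
                     refl Hy Fx Fy ⟩
        (Fx - (1ℚ - Hy) * (Fx - Fy)) + (Hy * (1ℚ + Fy) - Fy)
          ≡⟨ cong (λ z → (Fx - (1ℚ - Hy) * (Fx - Fy)) + (z - Fy)) (H*[1+F]≡F 0≤y y≤1) ⟩
        (Fx - (1ℚ - Hy) * (Fx - Fy)) + (Fy - Fy)
          ≡⟨ solve 3 (λ h a b → (a :- (con 1ℚ :- h) :* (a :- b)) :+ (b :- b) := a :- (con 1ℚ :- h) :* (a :- b))
                     refl Hy Fx Fy ⟩
        Fx - (1ℚ - Hy) * (Fx - Fy) ∎

    F*z₀≤z₁⇒H*[z₁+z₀]≤z₁ : ∀ {x z₀ z₁} → 0ℚ ≤ x → x ≤ 1ℚ → F m d x * z₀ ≤ z₁ → H m d x * (z₁ + z₀) ≤ z₁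
    F*z₀≤z₁⇒H*[z₁+z₀]≤z₁ {x} {z₀} {z₁} 0≤x x≤1 F*z₀≤z₁ = *-cancelʳ-≤ (0<1+F 0≤x x≤1) (begin
      (h * (z₁ + z₀)) * (1ℚ + f) ≡⟨ *-swapʳ h (z₁ + z₀) (1ℚ + f) ⟩
      (h * (1ℚ + f)) * (z₁ + z₀) ≡⟨ cong (_* (z₁ + z₀)) (H*[1+F]≡F 0≤x x≤1) ⟩
      f * (z₁ + z₀)              ≡⟨ *-distribˡ-+ f z₁ z₀ ⟩
      f * z₁ + f * z₀            ≤⟨ +-monoʳ-≤ (f * z₁) F*z₀≤z₁ ⟩
      f * z₁ + z₁                ≡⟨ solve 2 (λ f a → f :* a :+ a := a :* (con 1ℚ :+ f)) refl f z₁ ⟩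
      z₁ * (1ℚ + f)              ∎)
      where
      open ≤-Reasoning
      f = F m d x
      h = H m d x

    z₁≤F*z₀⇒z₁≤H*[z₁+z₀] : ∀ {x z₀ z₁} → 0ℚ ≤ x → x ≤ 1ℚ → z₁ ≤ F m d x * z₀ → z₁ ≤ H m d x * (z₁ + z₀)
    z₁≤F*z₀⇒z₁≤H*[z₁+z₀] {x} {z₀} {z₁} 0≤x x≤1 z₁≤F*z₀ = *-cancelʳ-≤ (0<1+F 0≤x x≤1) (begin
      z₁ * (1ℚ + f)              ≡⟨ solve 2 (λ f a → a :* (con 1ℚ :+ f) := f :* a :+ a) refl f z₁ ⟩
      f * z₁ + z₁                ≤⟨ +-monoʳ-≤ (f * z₁) z₁≤F*z₀ ⟩
      f * z₁ + f * z₀            ≡⟨ *-distribˡ-+ f z₁ z₀ ⟨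
      f * (z₁ + z₀)              ≡⟨ cong (_* (z₁ + z₀)) (H*[1+F]≡F 0≤x x≤1) ⟨
      (h * (1ℚ + f)) * (z₁ + z₀) ≡⟨ *-swapʳ h (1ℚ + f) (z₁ + z₀) ⟩
      (h * (z₁ + z₀)) * (1ℚ + f) ∎)
      where
      open ≤-Reasoning
      f = F m d x
      h = H m d x

  IsUnitSubinterval : ℚ → ℚ → Set
  IsUnitSubinterval lo hi = (0ℚ ≤ lo) × (lo ≤ hi) × (hi ≤ 1ℚ)

  infix 4 _/_∈[_,_]
  _/_∈[_,_] : ℕ → ℕ → ℚ → ℚ → Set
  o / t ∈[ lo , hi ] = (lo * fromℕ t ≤ fromℕ o) × (fromℕ o ≤ hi * fromℕ t)

  module _ {A : Set} (f g : A → ℕ) {c : ℚ} (0≤c : 0ℚ ≤ c) where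

    product-≤-scaled : ∀ {k} (xs : Vec A k) → All (λ x → fromℕ (f x) ≤ c * fromℕ (g x)) xs →
      fromℕ (product (Vec.map f xs)) ≤ c ^ k * fromℕ (product (Vec.map g xs))
    product-≤-scaled []       []         = ≤-reflexive (sym (*-identityˡ 1ℚ))
    product-≤-scaled {suc k} (x ∷ xs) (fx≤ ∷ fxs≤) = begin
      fromℕ (f x ℕ.* product (Vec.map f xs))              ≡⟨ fromℕ-* (f x) _ ⟩
      fromℕ (f x) * fromℕ (product (Vec.map f xs))        ≤⟨ *-mono-≤ (fromℕ-nonNeg _) (fromℕ-nonNeg _) fx≤
                                                                      (product-≤-scaled xs fxs≤) ⟩
      (c * gx) * (c ^ k * gxs)                             ≡⟨ *-interchange c gx (c ^ k) gxs ⟩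
      (c * c ^ k) * (gx * gxs)                             ≡⟨ cong ((c * c ^ k) *_) (fromℕ-* (g x) _) ⟨
      (c * c ^ k) * fromℕ (g x ℕ.* product (Vec.map g xs)) ∎
      where
      open ≤-Reasoning
      gx = fromℕ (g x)
      gxs = fromℕ (product (Vec.map g xs))

    scaled-≤-product : ∀ {k} (xs : Vec A k) → All (λ x → c * fromℕ (g x) ≤ fromℕ (f x)) xs →
      c ^ k * fromℕ (product (Vec.map g xs)) ≤ fromℕ (product (Vec.map f xs))
    scaled-≤-product []       []         = ≤-reflexive (*-identityˡ 1ℚ)
    scaled-≤-product {suc k} (x ∷ xs) (≤fx ∷ ≤fxs) = begin
      (c * c ^ k) * fromℕ (g x ℕ.* product (Vec.map g xs)) ≡⟨ cong ((c * c ^ k) *_) (fromℕ-* (g x) _) ⟩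
      (c * c ^ k) * (gx * gxs)                             ≡⟨ *-interchange c (c ^ k) gx gxs ⟩
      (c * gx) * (c ^ k * gxs)                             ≤⟨ *-mono-≤ (*-nonNeg 0≤c (fromℕ-nonNeg _))
                                                                      (*-nonNeg (^-nonNeg k 0≤c) (fromℕ-nonNeg _))
                                                                 ≤fx (scaled-≤-product xs ≤fxs) ⟩
      fromℕ (f x) * fromℕ (product (Vec.map f xs))        ≡⟨ fromℕ-* (f x) _ ⟨
      fromℕ (f x ℕ.* product (Vec.map f xs))              ∎
      where
      open ≤-Reasoning
      gx = fromℕ (g x)
      gxs = fromℕ (product (Vec.map g xs))

  module _ (m d n : ℕ) {lo hi : ℚ} (lo-hi : IsUnitSubinterval lo hi) where

    open PartitionFunctions m d

    private
      0≤lo = proj₁ lo-hi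
      0≤hi = ≤-trans 0≤lo (proj₁ (proj₂ lo-hi))
      hi≤1 = proj₂ (proj₂ lo-hi)
      lo≤1 = ≤-trans (proj₁ (proj₂ lo-hi)) hi≤1

      1-c*t≡t-c*t : ∀ c t → (1ℚ - c) * t ≡ t - c * t
      1-c*t≡t-c*t = solve 2 (λ c t → (con 1ℚ :- c) :* t := t :- c :* t) refl

    allowed-edge-bounds : ∀ row → All (λ c → Z⁺ n c / Z n c ∈[ lo , hi ]) row →
      childrenZ n row ∸ childrenZ⁺ n row / childrenZ n row ∈[ 1ℚ - hi ^ m , 1ℚ - lo ^ m ]
    allowed-edge-bounds row children∈ =
        subst₂ _≤_ (sym (1-c*t≡t-c*t (hi ^ m) t)) (sym allowed≡)
          (r-q≤r-p t (product-≤-scaled (Z⁺ n) (Z n) 0≤hi row (All.map proj₂ children∈)))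
      , subst₂ _≤_ (sym allowed≡) (sym (1-c*t≡t-c*t (lo ^ m) t))
          (r-q≤r-p t (scaled-≤-product (Z⁺ n) (Z n) 0≤lo row (All.map proj₁ children∈)))
      where
      t = fromℕ (childrenZ n row)
      allowed≡ : fromℕ (childrenZ n row ∸ childrenZ⁺ n row) ≡ t - fromℕ (childrenZ⁺ n row)
      allowed≡ = fromℕ-∸ (childrenZ⁺≤childrenZ n row)

    recursion-bounds : ∀ η → All (All (λ c → Z⁺ n c / Z n c ∈[ lo , hi ])) η →
      Z⁺ (suc n) η / Z (suc n) η ∈[ H m d hi , H m d lo ]
    recursion-bounds η children∈ = subst₂ (λ o t → o / t ∈[ H m d hi , H m d lo ]) (sym (Z⁺-suc n η)) (sym Z≡Z₁+Z₀)
        ( subst (λ t → H m d hi * t ≤ z₁) (sym (fromℕ-+ Z₁ Z₀))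
            (F*z₀≤z₁⇒H*[z₁+z₀]≤z₁ m d 0≤hi hi≤1
              (scaled-≤-product (λ row → childrenZ n row ∸ childrenZ⁺ n row) (childrenZ n) (0≤1-x^n m 0≤hi hi≤1) η
                (All.map (λ {row} → proj₁ ∘′ allowed-edge-bounds row) children∈)))
        , subst (λ t → z₁ ≤ H m d lo * t) (sym (fromℕ-+ Z₁ Z₀))
            (z₁≤F*z₀⇒z₁≤H*[z₁+z₀] m d 0≤lo lo≤1
              (product-≤-scaled (λ row → childrenZ n row ∸ childrenZ⁺ n row) (childrenZ n) (0≤1-x^n m 0≤lo lo≤1) η
                (All.map (λ {row} → proj₂ ∘′ allowed-edge-bounds row) children∈))))
      where
      Z₁ = product (Vec.map (λ row → childrenZ n row ∸ childrenZ⁺ n row) η)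
      Z₀ = product (Vec.map (childrenZ n) η)
      z₁ = fromℕ Z₁
      Z≡Z₁+Z₀ : Z (suc n) η ≡ Z₁ ℕ.+ Z₀
      Z≡Z₁+Z₀ = trans (Z-suc n η) (cong (ℕ._+ Z₀) (Z⁺-suc n η))

  ratio-∈ : ∀ {lo hi o t} → 1 ℕ.≤ t → o / t ∈[ lo , hi ] → lo ≤ ratio o t × ratio o t ≤ hi
  ratio-∈ {lo} {hi} {o} {suc t} _ (lo*t≤o , o≤hi*t) =
      *-cancelʳ-≤ (fromℕ-pos t) (subst (lo * fromℕ (suc t) ≤_) (sym (/-*-denominator o t)) lo*t≤o)
    , *-cancelʳ-≤ (fromℕ-pos t) (subst (_≤ hi * fromℕ (suc t)) (sym (/-*-denominator o t)) o≤hi*t)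

  ∣x-y∣≤hi-lo : ∀ {lo hi x y} → lo ≤ x × x ≤ hi → lo ≤ y × y ≤ hi → ∣ x - y ∣ ≤ hi - lo
  ∣x-y∣≤hi-lo {lo} {hi} {x} {y} (lo≤x , x≤hi) (lo≤y , y≤hi) with ∣p∣≡p∨∣p∣≡-p (x - y)
  ... | inj₁ ∣x-y∣≡x-y  = subst (_≤ hi - lo) (sym ∣x-y∣≡x-y) (+-mono-≤ x≤hi (neg-antimono-≤ lo≤y))
  ... | inj₂ ∣x-y∣≡y-x = subst (_≤ hi - lo) (sym (trans ∣x-y∣≡y-x (solve 2 (λ x y → :- (x :- y) := y :- x) refl x y)))
                           (+-mono-≤ y≤hi (neg-antimono-≤ lo≤x))

  module Iteration (m d : ℕ) where

    open PartitionFunctions m d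

    -- [lo n , hi n] is the image of [0 , 1] under n steps of the recursion; it contains the
    -- root marginal for every boundary condition at depth n.
    bounds : ℕ → ℚ × ℚ
    bounds zero    = 0ℚ , 1ℚ
    bounds (suc n) = H m d (proj₂ (bounds n)) , H m d (proj₁ (bounds n))

    lo hi : ℕ → ℚ
    lo n = proj₁ (bounds n)
    hi n = proj₂ (bounds n)

    H-preserves-⊆[0,1] : ∀ {l h} → IsUnitSubinterval l h → IsUnitSubinterval (H m d h) (H m d l)
    H-preserves-⊆[0,1] (0≤l , l≤h , h≤1) =
      H-nonNeg m d (≤-trans 0≤l l≤h) h≤1 , H-antitone m d 0≤l l≤h h≤1 , H-≤1 m d 0≤l (≤-trans l≤h h≤1)

    bounds-⊆[0,1] : ∀ n → IsUnitSubinterval (lo n) (hi n)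
    bounds-⊆[0,1] zero    = ≤-refl , 0≤1 , ≤-refl
    bounds-⊆[0,1] (suc n) = H-preserves-⊆[0,1] (bounds-⊆[0,1] n)

    H-preserves-⊆ : ∀ {l h l′ h′} → IsUnitSubinterval l h → IsUnitSubinterval l′ h′ → l ≤ l′ → h′ ≤ h →
                    H m d h ≤ H m d h′ × H m d l′ ≤ H m d l
    H-preserves-⊆ (0≤l , _ , h≤1) (_ , l′≤h′ , h′≤1) l≤l′ h′≤h =
      H-antitone m d (≤-trans 0≤l (≤-trans l≤l′ l′≤h′)) h′≤h h≤1 , H-antitone m d 0≤l l≤l′ (≤-trans l′≤h′ h′≤1)

    bounds-nested : ∀ n → lo n ≤ lo (suc n) × hi (suc n) ≤ hi n
    bounds-nested zero    = H-nonNeg m d 0≤1 ≤-refl , H-≤1 m d ≤-refl 0≤1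
    bounds-nested (suc n) =
      H-preserves-⊆ (bounds-⊆[0,1] n) (bounds-⊆[0,1] (suc n)) (proj₁ (bounds-nested n)) (proj₂ (bounds-nested n))

    bounds-nested* : ∀ n k → lo n ≤ lo (k ℕ.+ n) × hi (k ℕ.+ n) ≤ hi n
    bounds-nested* n zero    = ≤-refl , ≤-refl
    bounds-nested* n (suc k) =
      ≤-trans (proj₁ (bounds-nested* n k)) (proj₁ (bounds-nested (k ℕ.+ n))) ,
      ≤-trans (proj₂ (bounds-nested (k ℕ.+ n))) (proj₂ (bounds-nested* n k))

    ratio-bounds : ∀ n (η : Leaves m d n) → Z⁺ n η / Z n η ∈[ lo n , hi n ]
    ratio-bounds zero    true  = ≤ᵇ⇒≤ tt , ≤ᵇ⇒≤ tt
    ratio-bounds zero    false = ≤ᵇ⇒≤ tt , ≤ᵇ⇒≤ tt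
    ratio-bounds (suc n) η =
      recursion-bounds m d n (bounds-⊆[0,1] n) η (All.universal (All.universal (ratio-bounds n)) η)

    condProb-diff≤width : ∀ n (η η′ : Leaves m d n) →
      ∣ condProb (suc m) (suc d) n η - condProb (suc m) (suc d) n η′ ∣ ≤ hi n - lo n
    condProb-diff≤width n η η′ = ∣x-y∣≤hi-lo (marginal-bounds η) (marginal-bounds η′)
      where
      marginal-bounds : ∀ η → lo n ≤ condProb (suc m) (suc d) n η × condProb (suc m) (suc d) n η ≤ hi n
      marginal-bounds η = ratio-∈ {o = Z⁺ n η} (Z-positive n η) (ratio-bounds n η)

    width→0⇒uniqueness : (∀ ε → 0ℚ < ε → ∃[ N ] (∀ n → N ℕ.≤ n → hi n - lo n ≤ ε)) → Uniqueness (suc m) (suc d)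
    width→0⇒uniqueness width→0 ε 0<ε with width→0 ε 0<ε
    ... | N , width≤ε = N , λ n N≤n η η′ → ≤-trans (condProb-diff≤width n η η′) (width≤ε n N≤n)

    contraction⇒width→0 : ∀ {L u₁ u₂} N → 0ℚ ≤ L → (∀ ε → 0ℚ < ε → ∃[ k ] (L ^ k ≤ ε)) →
      u₁ ≤ lo N → hi N ≤ u₂ →
      (∀ {p q} → u₁ ≤ p → p ≤ q → q ≤ u₂ → H m d p - H m d q ≤ L * (q - p)) →
      ∀ ε → 0ℚ < ε → ∃[ M ] (∀ n → M ℕ.≤ n → hi n - lo n ≤ ε)
    contraction⇒width→0 {L} {u₁} {u₂} N 0≤L L^k→0 u₁≤lo hi≤u₂ contracts ε 0<ε with L^k→0 ε 0<ε
    ... | k , L^k≤ε = k ℕ.+ N , λ n k+N≤n → subst (λ n → hi n - lo n ≤ ε) (ℕ.m∸n+n≡m k+N≤n) (later (n ∸ (k ℕ.+ N)))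
      where
      width : ℕ → ℚ
      width n = hi n - lo n

      width-decay : ∀ j → width (j ℕ.+ N) ≤ L ^ j
      width-decay zero =
        let (0≤lo , _ , hi≤1) = bounds-⊆[0,1] N in
        subst (width N ≤_) (solve 0 (con 1ℚ :- con 0ℚ := con 1ℚ) refl) (+-mono-≤ hi≤1 (neg-antimono-≤ 0≤lo))
      width-decay (suc j) =
        let (lo≤ , ≤hi) = bounds-nested* N j
            (_ , lo≤hi , _) = bounds-⊆[0,1] (j ℕ.+ N)
        in ≤-trans (contracts (≤-trans u₁≤lo lo≤) lo≤hi (≤-trans ≤hi hi≤u₂)) (*-monoˡ-≤ 0≤L (width-decay j))

      later : ∀ j → width (j ℕ.+ (k ℕ.+ N)) ≤ ε
      later j =
        let (lo≤ , ≤hi) = bounds-nested* (k ℕ.+ N) j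
        in ≤-trans (+-mono-≤ ≤hi (neg-antimono-≤ lo≤)) (≤-trans (width-decay k) L^k≤ε)

  -- An upper bound for the derivative of -F on [u₁ , u₂].
  F′-bound : ℕ → ℕ → ℚ → ℚ → ℚ
  F′-bound m d u₁ u₂ = fromℕ d * (1ℚ - u₁ ^ m) ^ (d ∸ 1) * (fromℕ m * u₂ ^ (m ∸ 1))

  module _ (m d : ℕ) {u₁ u₂ p q : ℚ}
           (0≤u₁ : 0ℚ ≤ u₁) (u₁≤p : u₁ ≤ p) (p≤q : p ≤ q) (q≤u₂ : q ≤ u₂) (u₂≤1 : u₂ ≤ 1ℚ) where

    private
      0≤p = ≤-trans 0≤u₁ u₁≤p
      0≤q = ≤-trans 0≤p p≤q
      q≤1 = ≤-trans q≤u₂ u₂≤1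
      p≤1 = ≤-trans p≤q q≤1

    F-slope : F m d p - F m d q ≤ F′-bound m d u₁ u₂ * (q - p)
    F-slope = begin
      X ^ d - Y ^ d
        ≤⟨ x^n-y^n≤n*x^[n-1]*[x-y] d 0≤Y Y≤X ⟩
      fromℕ d * X ^ (d ∸ 1) * (X - Y)
        ≤⟨ *-mono₃-≤ (fromℕ-nonNeg d) (^-nonNeg (d ∸ 1) 0≤X) (p≤q⇒0≤q-p Y≤X) ≤-refl
             (^-mono-≤ (d ∸ 1) 0≤X (r-q≤r-p 1ℚ (^-mono-≤ m 0≤u₁ u₁≤p))) X-Y≤ ⟩
      fromℕ d * (1ℚ - u₁ ^ m) ^ (d ∸ 1) * (fromℕ m * u₂ ^ (m ∸ 1) * (q - p))
        ≡⟨ solve 4 (λ a b c e → a :* b :* (c :* e) := a :* b :* c :* e) refl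
             (fromℕ d) ((1ℚ - u₁ ^ m) ^ (d ∸ 1)) (fromℕ m * u₂ ^ (m ∸ 1)) (q - p) ⟩
      F′-bound m d u₁ u₂ * (q - p) ∎
      where
      open ≤-Reasoning
      X = 1ℚ - p ^ m
      Y = 1ℚ - q ^ m
      0≤X = 0≤1-x^n m 0≤p p≤1
      0≤Y = 0≤1-x^n m 0≤q q≤1
      Y≤X : Y ≤ X
      Y≤X = r-q≤r-p 1ℚ (^-mono-≤ m 0≤p p≤q)
      X-Y≤ : X - Y ≤ fromℕ m * u₂ ^ (m ∸ 1) * (q - p)
      X-Y≤ = begin
        X - Y
          ≡⟨ solve 2 (λ a b → (con 1ℚ :- a) :- (con 1ℚ :- b) := b :- a) refl (p ^ m) (q ^ m) ⟩
        q ^ m - p ^ m                        ≤⟨ x^n-y^n≤n*x^[n-1]*[x-y] m 0≤p p≤q ⟩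
        fromℕ m * q ^ (m ∸ 1) * (q - p)      ≤⟨ *-mono₃-≤ (fromℕ-nonNeg m) (^-nonNeg (m ∸ 1) 0≤q) (p≤q⇒0≤q-p p≤q)
                                                   ≤-refl (^-mono-≤ (m ∸ 1) 0≤q q≤u₂) ≤-refl ⟩
        fromℕ m * u₂ ^ (m ∸ 1) * (q - p)     ∎

    H-slope : ∀ {L} → 0ℚ ≤ L → F′-bound m d u₁ u₂ ≤ L * ((1ℚ + F m d u₂) * (1ℚ + F m d u₂)) →
              H m d p - H m d q ≤ L * (q - p)
    H-slope {L} 0≤L F′≤L*[1+F]² = *-cancelʳ-≤ 0<W (begin
      (H m d p - H m d q) * W     ≡⟨ [Hp-Hq]*W≡Fp-Fq ⟩
      Fp - Fq                     ≤⟨ F-slope ⟩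
      F′-bound m d u₁ u₂ * (q - p) ≤⟨ *-monoʳ-≤ (p≤q⇒0≤q-p p≤q) F′≤L*[1+F]² ⟩
      L * ((1ℚ + Fu) * (1ℚ + Fu)) * (q - p)
        ≤⟨ *-mono₃-≤ 0≤L (*-nonNeg 0≤1+Fu 0≤1+Fu) (p≤q⇒0≤q-p p≤q) ≤-refl
             (*-mono-≤ 0≤1+Fu 0≤1+Fu (+-monoʳ-≤ 1ℚ (F-antitone m d 0≤p (≤-trans p≤q q≤u₂) u₂≤1))
                                     (+-monoʳ-≤ 1ℚ (F-antitone m d 0≤q q≤u₂ u₂≤1))) ≤-refl ⟩
      L * W * (q - p)             ≡⟨ solve 3 (λ l w e → l :* w :* e := l :* e :* w) refl L W (q - p) ⟩
      L * (q - p) * W             ∎)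
      where
      open ≤-Reasoning
      Fp = F m d p
      Fq = F m d q
      Fu = F m d u₂
      W = (1ℚ + Fp) * (1ℚ + Fq)
      0≤1+Fu : 0ℚ ≤ 1ℚ + Fu
      0≤1+Fu = <⇒≤ (0<1+F m d (≤-trans 0≤q q≤u₂) u₂≤1)
      0<W : 0ℚ < W
      0<W = *-pos (0<1+F m d 0≤p p≤1) (0<1+F m d 0≤q q≤1)
      [Hp-Hq]*W≡Fp-Fq : (H m d p - H m d q) * W ≡ Fp - Fq
      [Hp-Hq]*W≡Fp-Fq = begin-equality
        (H m d p - H m d q) * W
          ≡⟨ solve 4 (λ a b f g → (a :- b) :* ((con 1ℚ :+ f) :* (con 1ℚ :+ g))
                               := a :* (con 1ℚ :+ f) :* (con 1ℚ :+ g) :- b :* (con 1ℚ :+ g) :* (con 1ℚ :+ f))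
                     refl (H m d p) (H m d q) Fp Fq ⟩
        H m d p * (1ℚ + Fp) * (1ℚ + Fq) - H m d q * (1ℚ + Fq) * (1ℚ + Fp)
          ≡⟨ cong₂ (λ a b → a * (1ℚ + Fq) - b * (1ℚ + Fp)) (H*[1+F]≡F m d 0≤p p≤1) (H*[1+F]≡F m d 0≤q q≤1) ⟩
        Fp * (1ℚ + Fq) - Fq * (1ℚ + Fp)
          ≡⟨ solve 2 (λ f g → f :* (con 1ℚ :+ g) :- g :* (con 1ℚ :+ f) := f :- g) refl Fp Fq ⟩
        Fp - Fq ∎

  module _ (m d : ℕ) where

    open PartitionFunctions m d

    uniform : Bool → ∀ n → Leaves m d n
    uniform v zero    = v
    uniform v (suc n) = replicate d (replicate m (uniform v n))

    private
      All-replicate : ∀ {A : Set} {P : A → Set} {x} k → P x → All P (replicate k x)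
      All-replicate zero    px = []
      All-replicate (suc k) px = px ∷ All-replicate k px

      twice : ℕ → ℕ
      twice zero    = zero
      twice (suc n) = suc (suc (twice n))

      n≤twice-n : ∀ n → n ℕ.≤ twice n
      n≤twice-n zero    = ℕ.z≤n
      n≤twice-n (suc n) = ℕ.m≤n⇒m≤1+n (ℕ.s≤s (n≤twice-n n))

      widen : ∀ {lo hi lo′ hi′ o t} → lo′ ≤ lo → hi ≤ hi′ → o / t ∈[ lo , hi ] → o / t ∈[ lo′ , hi′ ]
      widen {t = t} lo′≤lo hi≤hi′ (lo*t≤o , o≤hi*t) =
        ≤-trans (*-monoʳ-≤ (fromℕ-nonNeg t) lo′≤lo) lo*t≤o , ≤-trans o≤hi*t (*-monoʳ-≤ (fromℕ-nonNeg t) hi≤hi′)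

      uniform-step : ∀ {lo hi lo′ hi′} v n → IsUnitSubinterval lo hi → lo′ ≤ H m d hi → H m d lo ≤ hi′ →
        Z⁺ n (uniform v n) / Z n (uniform v n) ∈[ lo , hi ] →
        Z⁺ (suc n) (uniform v (suc n)) / Z (suc n) (uniform v (suc n)) ∈[ lo′ , hi′ ]
      uniform-step v n lo-hi lo′≤ ≤hi′ children∈ =
        widen lo′≤ ≤hi′ (recursion-bounds m d n lo-hi (uniform v (suc n)) (All-replicate d (All-replicate m children∈)))

    -- With all-occupied (resp. all-vacant) leaves at even depth the root marginal stays in [b , 1]
    -- (resp. [0 , c]), since the recursion swaps these two intervals.
    module _ {b c : ℚ} (0≤c : 0ℚ ≤ c) (c<b : c < b) (b≤1 : b ≤ 1ℚ) (Hb≤c : H m d b ≤ c) (b≤Hc : b ≤ H m d c) where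

      private
        c≤b = <⇒≤ c<b
        [b,1] : IsUnitSubinterval b 1ℚ
        [b,1] = ≤-trans 0≤c c≤b , b≤1 , ≤-refl
        [0,c] : IsUnitSubinterval 0ℚ c
        [0,c] = ≤-refl , 0≤c , ≤-trans c≤b b≤1

      occupied-even-depth : ∀ n → Z⁺ (twice n) (uniform true (twice n)) / Z (twice n) (uniform true (twice n)) ∈[ b , 1ℚ ]
      occupied-even-depth zero    = subst (_≤ 1ℚ) (sym (*-identityʳ b)) b≤1 , ≤ᵇ⇒≤ tt
      occupied-even-depth (suc n) = uniform-step true (suc (twice n)) [0,c] b≤Hc (H-≤1 m d ≤-refl 0≤1)
        (uniform-step true (twice n) [b,1] (H-nonNeg m d 0≤1 ≤-refl) Hb≤c (occupied-even-depth n))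

      vacant-even-depth : ∀ n → Z⁺ (twice n) (uniform false (twice n)) / Z (twice n) (uniform false (twice n)) ∈[ 0ℚ , c ]
      vacant-even-depth zero    = ≤ᵇ⇒≤ tt , subst (0ℚ ≤_) (sym (*-identityʳ c)) 0≤c
      vacant-even-depth (suc n) = uniform-step false (suc (twice n)) [b,1] (H-nonNeg m d 0≤1 ≤-refl) Hb≤c
        (uniform-step false (twice n) [0,c] b≤Hc (H-≤1 m d ≤-refl 0≤1) (vacant-even-depth n))

      two-cycle⇒¬uniqueness : ¬ Uniqueness (suc m) (suc d)
      two-cycle⇒¬uniqueness uniqueness = <-irrefl refl (begin-strict
        0ℚ             <⟨ 0<ε ⟩
        ε              ≡⟨ solve 1 (λ g → g :* con ½ := g :- g :* con ½) refl gap ⟩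
        gap - ε        ≤⟨ +-monoˡ-≤ (- ε) gap≤ε ⟩
        ε - ε          ≡⟨ +-inverseʳ ε ⟩
        0ℚ             ∎)
        where
        open ≤-Reasoning
        gap = b - c
        ε = gap * ½
        0<ε : 0ℚ < ε
        0<ε = *-pos (subst (_< gap) (+-inverseʳ c) (+-monoˡ-< (- c) c<b)) (positive⁻¹ ½)

        N = proj₁ (uniqueness ε 0<ε)
        n = twice N
        all-occupied = uniform true n
        all-vacant = uniform false n
        x = condProb (suc m) (suc d) n all-occupied
        y = condProb (suc m) (suc d) n all-vacant
        gap≤x-y : gap ≤ x - y
        gap≤x-y = +-mono-≤
          (proj₁ (ratio-∈ {b} {1ℚ} {Z⁺ n all-occupied} (Z-positive n all-occupied) (occupied-even-depth N)))
          (neg-antimono-≤ (proj₂ (ratio-∈ {0ℚ} {c} {Z⁺ n all-vacant} (Z-positive n all-vacant) (vacant-even-depth N))))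
        gap≤ε : gap ≤ ε
        gap≤ε = ≤-trans gap≤x-y (subst (_≤ ε) (0≤p⇒∣p∣≡p (≤-trans (p≤q⇒0≤q-p c≤b) gap≤x-y))
                                         (proj₂ (uniqueness ε 0<ε) n (n≤twice-n N) all-occupied all-vacant))

  module LargeDegree where

    -- For d ≥ 90 the pair b = 43/100, c = (68/69)^d is a two-cycle of the recursion with m = 5.
    -- The constants are opaque so that typechecking never unfolds their large powers.
    opaque
      b q : ℚ
      b = + 43 / 100
      q = + 68 / 69

      1-b⁵≤q : 1ℚ - b ^ 5 ≤ q
      1-b⁵≤q = ≤ᵇ⇒≤ tt

      b≤⅘[1-b] : b ≤ + 4 / 5 * (1ℚ - b)
      b≤⅘[1-b] = ≤ᵇ⇒≤ tt

      q⁹⁰<b : q ^ 90 < b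
      q⁹⁰<b = toWitness {a? = q ^ 90 <? b} tt

      91q⁵≤90 : fromℕ 91 * q ^ 5 ≤ fromℕ 90
      91q⁵≤90 = ≤ᵇ⇒≤ tt

      90[q⁵]⁹⁰≤⅕ : fromℕ 90 * (q ^ 5) ^ 90 ≤ + 1 / 5
      90[q⁵]⁹⁰≤⅕ = ≤ᵇ⇒≤ tt

      0≤b : 0ℚ ≤ b
      0≤b = ≤ᵇ⇒≤ tt

      b≤1 : b ≤ 1ℚ
      b≤1 = ≤ᵇ⇒≤ tt

      0≤q : 0ℚ ≤ q
      0≤q = ≤ᵇ⇒≤ tt

      q≤1 : q ≤ 1ℚ
      q≤1 = ≤ᵇ⇒≤ tt

    r : ℚ
    r = q ^ 5

    0≤r : 0ℚ ≤ r
    0≤r = ^-nonNeg 5 0≤q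

    r≤1 : r ≤ 1ℚ
    r≤1 = ^-≤1 5 0≤q q≤1

    dr^d≤⅕ : ∀ j → fromℕ (j ℕ.+ 90) * r ^ (j ℕ.+ 90) ≤ + 1 / 5
    dr^d≤⅕ zero    = 90[q⁵]⁹⁰≤⅕
    dr^d≤⅕ (suc j) = ≤-trans step (dr^d≤⅕ j)
      where
      d = j ℕ.+ 90
      [d+1]r≤d : fromℕ (suc d) * r ≤ fromℕ d
      [d+1]r≤d = begin
        fromℕ (suc d) * r              ≡⟨ cong (λ z → fromℕ z * r) (sym (ℕ.+-suc j 90)) ⟩
        fromℕ (j ℕ.+ 91) * r           ≡⟨ cong (_* r) (fromℕ-+ j 91) ⟩
        (fromℕ j + fromℕ 91) * r       ≡⟨ *-distribʳ-+ r (fromℕ j) (fromℕ 91) ⟩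
        fromℕ j * r + fromℕ 91 * r
          ≤⟨ +-mono-≤ (subst (fromℕ j * r ≤_) (*-identityʳ (fromℕ j)) (*-monoˡ-≤ (fromℕ-nonNeg j) r≤1)) 91q⁵≤90 ⟩
        fromℕ j + fromℕ 90             ≡⟨ fromℕ-+ j 90 ⟨
        fromℕ d                        ∎
        where open ≤-Reasoning
      step : fromℕ (suc d) * (r * r ^ d) ≤ fromℕ d * r ^ d
      step = subst (_≤ fromℕ d * r ^ d) (*-assoc (fromℕ (suc d)) r (r ^ d)) (*-monoʳ-≤ (^-nonNeg d 0≤r) [d+1]r≤d)

    module _ (j : ℕ) where

      private
        d = j ℕ.+ 90
        c = q ^ d
        0≤c = ^-nonNeg d 0≤q
        c≤1 = ^-≤1 d 0≤q q≤1

      q^d<b : q ^ d < b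
      q^d<b = ≤-<-trans (subst (_≤ q ^ 90) (sym (^-homo-* q j 90)) (subst (q ^ j * q ^ 90 ≤_) (*-identityˡ (q ^ 90))
                          (*-monoʳ-≤ (^-nonNeg 90 0≤q) (^-≤1 j 0≤q q≤1)))) q⁹⁰<b

      ⅘≤F[q^d] : + 4 / 5 ≤ F 5 d c
      ⅘≤F[q^d] = begin
        + 4 / 5                  ≡⟨ refl ⟩
        1ℚ - + 1 / 5             ≤⟨ r-q≤r-p 1ℚ (subst (λ z → fromℕ d * z ≤ + 1 / 5) (sym c⁵≡r^d) (dr^d≤⅕ j)) ⟩
        1ℚ - fromℕ d * c ^ 5     ≤⟨ bernoulli d (^-nonNeg 5 0≤c) (^-≤1 5 0≤c c≤1) ⟩
        F 5 d c                  ∎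
        where
        open ≤-Reasoning
        c⁵≡r^d : c ^ 5 ≡ r ^ d
        c⁵≡r^d = trans (^-assocʳ q d 5) (trans (cong (q ^_) (ℕ.*-comm d 5)) (sym (^-assocʳ q 5 d)))

      b≤H[q^d] : b ≤ H 5 d c
      b≤H[q^d] = y*[1+F]≤F⇒y≤H 5 d 0≤c c≤1 (begin
        b * (1ℚ + Fc)            ≡⟨ solve 2 (λ b f → b :* (con 1ℚ :+ f) := b :+ b :* f) refl b Fc ⟩
        b + b * Fc               ≤⟨ +-monoˡ-≤ (b * Fc) (≤-trans b≤⅘[1-b] (*-monoʳ-≤ (p≤q⇒0≤q-p b≤1) ⅘≤F[q^d])) ⟩
        Fc * (1ℚ - b) + b * Fc   ≡⟨ solve 2 (λ b f → f :* (con 1ℚ :- b) :+ b :* f := f) refl b Fc ⟩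
        Fc                       ∎)
        where
        open ≤-Reasoning
        Fc = F 5 d c

      H[b]≤q^d : H 5 d b ≤ c
      H[b]≤q^d = F≤y*[1+F]⇒H≤y 5 d 0≤b b≤1 (begin
        F 5 d b                  ≤⟨ ^-mono-≤ d (0≤1-x^n 5 0≤b b≤1) 1-b⁵≤q ⟩
        c                        ≡⟨ *-identityʳ c ⟨
        c * 1ℚ
          ≤⟨ *-monoˡ-≤ 0≤c (subst (_≤ 1ℚ + F 5 d b) (+-identityʳ 1ℚ) (+-monoʳ-≤ 1ℚ (F-nonNeg 5 d 0≤b b≤1))) ⟩
        c * (1ℚ + F 5 d b)       ∎)
        where open ≤-Reasoning

      nonuniqueness : ¬ Uniqueness 6 (suc d)
      nonuniqueness = two-cycle⇒¬uniqueness 5 d 0≤c q^d<b b≤1 H[b]≤q^d b≤H[q^d]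

  -- Transfer from unnormalised rationals

  module _ (p q : ℚᵘ.ℚᵘ) where

    private
      p≃ = ℚᵘ.≃-sym (toℚᵘ-fromℚᵘ p)
      q≃ = ℚᵘ.≃-sym (toℚᵘ-fromℚᵘ q)

    fromℚᵘ-+ : fromℚᵘ (p ℚᵘ.+ q) ≡ fromℚᵘ p + fromℚᵘ q
    fromℚᵘ-+ = toℚᵘ-injective (ℚᵘ.≃-trans (toℚᵘ-fromℚᵘ (p ℚᵘ.+ q))
                 (ℚᵘ.≃-trans (ℚᵘ.+-cong p≃ q≃) (ℚᵘ.≃-sym (toℚᵘ-homo-+ (fromℚᵘ p) (fromℚᵘ q)))))

    fromℚᵘ-* : fromℚᵘ (p ℚᵘ.* q) ≡ fromℚᵘ p * fromℚᵘ q
    fromℚᵘ-* = toℚᵘ-injective (ℚᵘ.≃-trans (toℚᵘ-fromℚᵘ (p ℚᵘ.* q))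
                 (ℚᵘ.≃-trans (ℚᵘ.*-cong p≃ q≃) (ℚᵘ.≃-sym (toℚᵘ-homo-* (fromℚᵘ p) (fromℚᵘ q)))))

    fromℚᵘ-mono-≤ : p ℚᵘ.≤ q → fromℚᵘ p ≤ fromℚᵘ q
    fromℚᵘ-mono-≤ p≤q = toℚᵘ-cancel-≤ (ℚᵘ.≤-respˡ-≃ p≃ (ℚᵘ.≤-respʳ-≃ q≃ p≤q))

    fromℚᵘ-mono-< : p ℚᵘ.< q → fromℚᵘ p < fromℚᵘ q
    fromℚᵘ-mono-< p<q = toℚᵘ-cancel-< (ℚᵘ.<-respˡ-≃ p≃ (ℚᵘ.<-respʳ-≃ q≃ p<q))

  fromℚᵘ-neg : ∀ q → fromℚᵘ (ℚᵘ.- q) ≡ - fromℚᵘ q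
  fromℚᵘ-neg q = toℚᵘ-injective (ℚᵘ.≃-trans (toℚᵘ-fromℚᵘ (ℚᵘ.- q))
                   (ℚᵘ.≃-trans (ℚᵘ.-‿cong (ℚᵘ.≃-sym (toℚᵘ-fromℚᵘ q))) (ℚᵘ.≃-sym (toℚᵘ-homo‿- (fromℚᵘ q)))))

  fromℚᵘ-minus : ∀ p q → fromℚᵘ (p ℚᵘ.- q) ≡ fromℚᵘ p - fromℚᵘ q
  fromℚᵘ-minus p q = trans (fromℚᵘ-+ p (ℚᵘ.- q)) (cong (λ z → fromℚᵘ p + z) (fromℚᵘ-neg q))

  fromℚᵘ-^ : ∀ p n → fromℚᵘ (p ^ᵘ n) ≡ fromℚᵘ p ^ n
  fromℚᵘ-^ p zero    = refl
  fromℚᵘ-^ p (suc n) = trans (fromℚᵘ-* p (p ^ᵘ n)) (cong (fromℚᵘ p *_) (fromℚᵘ-^ p n))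

  fromℚᵘ-1-x^n : ∀ x n → fromℚᵘ (ℚᵘ.1ℚᵘ ℚᵘ.- x ^ᵘ n) ≡ 1ℚ - fromℚᵘ x ^ n
  fromℚᵘ-1-x^n x n = trans (fromℚᵘ-minus ℚᵘ.1ℚᵘ (x ^ᵘ n)) (cong (λ z → 1ℚ - z) (fromℚᵘ-^ x n))

  fromℚᵘ-fromℕ : ∀ n → fromℚᵘ (+ n ℚᵘ./ 1) ≡ fromℕ n
  fromℚᵘ-fromℕ n = toℚᵘ-injective (toℚᵘ-fromℚᵘ (+ n ℚᵘ./ 1))

  Fᵘ : ℕ → ℕ → ℚᵘ.ℚᵘ → ℚᵘ.ℚᵘ
  Fᵘ m d x = (ℚᵘ.1ℚᵘ ℚᵘ.- x ^ᵘ m) ^ᵘ d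

  F′-boundᵘ : ℕ → ℕ → ℚᵘ.ℚᵘ → ℚᵘ.ℚᵘ → ℚᵘ.ℚᵘ
  F′-boundᵘ m d u₁ u₂ = (+ d ℚᵘ./ 1) ℚᵘ.* (ℚᵘ.1ℚᵘ ℚᵘ.- u₁ ^ᵘ m) ^ᵘ (d ∸ 1) ℚᵘ.* ((+ m ℚᵘ./ 1) ℚᵘ.* u₂ ^ᵘ (m ∸ 1))

  module _ (m d : ℕ) where

    fromℚᵘ-F : ∀ x → fromℚᵘ (Fᵘ m d x) ≡ F m d (fromℚᵘ x)
    fromℚᵘ-F x = trans (fromℚᵘ-^ _ d) (cong (_^ d) (fromℚᵘ-1-x^n x m))

    fromℚᵘ-1+F : ∀ x → fromℚᵘ (ℚᵘ.1ℚᵘ ℚᵘ.+ Fᵘ m d x) ≡ 1ℚ + F m d (fromℚᵘ x)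
    fromℚᵘ-1+F x = trans (fromℚᵘ-+ ℚᵘ.1ℚᵘ (Fᵘ m d x)) (cong (λ z → 1ℚ + z) (fromℚᵘ-F x))

    fromℚᵘ-y*[1+F] : ∀ x y → fromℚᵘ (y ℚᵘ.* (ℚᵘ.1ℚᵘ ℚᵘ.+ Fᵘ m d x)) ≡ fromℚᵘ y * (1ℚ + F m d (fromℚᵘ x))
    fromℚᵘ-y*[1+F] x y = trans (fromℚᵘ-* y _) (cong (fromℚᵘ y *_) (fromℚᵘ-1+F x))

    fromℚᵘ-F′-bound : ∀ u₁ u₂ → fromℚᵘ (F′-boundᵘ m d u₁ u₂) ≡ F′-bound m d (fromℚᵘ u₁) (fromℚᵘ u₂)
    fromℚᵘ-F′-bound u₁ u₂ = begin
      fromℚᵘ (D ℚᵘ.* A ℚᵘ.* (M ℚᵘ.* B))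
        ≡⟨ trans (fromℚᵘ-* (D ℚᵘ.* A) _) (cong₂ _*_ (fromℚᵘ-* D A) (fromℚᵘ-* M B)) ⟩
      fromℚᵘ D * fromℚᵘ A * (fromℚᵘ M * fromℚᵘ B)
        ≡⟨ cong₂ (λ x y → x * fromℚᵘ A * (y * fromℚᵘ B)) (fromℚᵘ-fromℕ d) (fromℚᵘ-fromℕ m) ⟩
      fromℕ d * fromℚᵘ A * (fromℕ m * fromℚᵘ B)
        ≡⟨ cong₂ (λ a b → fromℕ d * a * (fromℕ m * b))
             (trans (fromℚᵘ-^ _ (d ∸ 1)) (cong (_^ (d ∸ 1)) (fromℚᵘ-1-x^n u₁ m)))
             (fromℚᵘ-^ u₂ (m ∸ 1)) ⟩
      F′-bound m d (fromℚᵘ u₁) (fromℚᵘ u₂) ∎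
      where
      open ≡-Reasoning
      D = + d ℚᵘ./ 1
      M = + m ℚᵘ./ 1
      A = (ℚᵘ.1ℚᵘ ℚᵘ.- u₁ ^ᵘ m) ^ᵘ (d ∸ 1)
      B = u₂ ^ᵘ (m ∸ 1)

  T-∧⁻ : ∀ {a b} → T (a ∧ b) → T a × T b
  T-∧⁻ = Equivalence.to T-∧

  checked-≤ : ∀ {p q} → T (p ℚᵘ.≤ᵇ q) → fromℚᵘ p ≤ fromℚᵘ q
  checked-≤ {p} {q} p≤q = fromℚᵘ-mono-≤ p q (ℚᵘ.≤ᵇ⇒≤ p≤q)

  checked-< : ∀ {p q} → T (not (q ℚᵘ.≤ᵇ p)) → fromℚᵘ p < fromℚᵘ q
  checked-< {p} {q} q≰p =
    fromℚᵘ-mono-< p q (ℚᵘ.≰⇒> (λ q≤p → subst T (Equivalence.to T-not-≡ q≰p) (ℚᵘ.≤⇒≤ᵇ q≤p)))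

  -- The certificates below are checked by evaluating ℚᵘ.≤ᵇ: unnormalised arithmetic computes
  -- no gcds, which makes the checks fast.
  module Certificates (m d : ℕ) where

    open Iteration m d

    private
      1+Fᵘ : ℚᵘ.ℚᵘ → ℚᵘ.ℚᵘ
      1+Fᵘ x = ℚᵘ.1ℚᵘ ℚᵘ.+ Fᵘ m d x

    belowH? : ℚᵘ.ℚᵘ → ℚᵘ.ℚᵘ → Bool
    belowH? y x = y ℚᵘ.* 1+Fᵘ x ℚᵘ.≤ᵇ Fᵘ m d x

    aboveH? : ℚᵘ.ℚᵘ → ℚᵘ.ℚᵘ → Bool
    aboveH? y x = Fᵘ m d x ℚᵘ.≤ᵇ y ℚᵘ.* 1+Fᵘ x

    module _ {x y : ℚᵘ.ℚᵘ} (0≤x : 0ℚ ≤ fromℚᵘ x) (x≤1 : fromℚᵘ x ≤ 1ℚ) where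

      belowH?-sound : T (belowH? y x) → fromℚᵘ y ≤ H m d (fromℚᵘ x)
      belowH?-sound y≤Hx = y*[1+F]≤F⇒y≤H m d 0≤x x≤1
        (subst₂ _≤_ (fromℚᵘ-y*[1+F] m d x y) (fromℚᵘ-F m d x) (checked-≤ {y ℚᵘ.* 1+Fᵘ x} {Fᵘ m d x} y≤Hx))

      aboveH?-sound : T (aboveH? y x) → H m d (fromℚᵘ x) ≤ fromℚᵘ y
      aboveH?-sound Hx≤y = F≤y*[1+F]⇒H≤y m d 0≤x x≤1
        (subst₂ _≤_ (fromℚᵘ-F m d x) (fromℚᵘ-y*[1+F] m d x y) (checked-≤ {Fᵘ m d x} {y ℚᵘ.* 1+Fᵘ x} Hx≤y))

    -- A chain lists intervals [a , b] enclosing the successive [lo i , hi i], starting from [0 , 1];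
    -- each step is certified by a′ ≤ H b and H a ≤ b′.
    Encloses : ℕ → ℚᵘ.ℚᵘ × ℚᵘ.ℚᵘ → Set
    Encloses i (a , b) = fromℚᵘ a ≤ lo i × hi i ≤ fromℚᵘ b

    step? : ℚᵘ.ℚᵘ × ℚᵘ.ℚᵘ → ℚᵘ.ℚᵘ × ℚᵘ.ℚᵘ → Bool
    step? (a , b) (a′ , b′) = (ℚᵘ.0ℚᵘ ℚᵘ.≤ᵇ a) ∧ (b ℚᵘ.≤ᵇ ℚᵘ.1ℚᵘ) ∧ belowH? a′ b ∧ aboveH? b′ a

    step-sound : ∀ i {ab ab′} → T (step? ab ab′) → Encloses i ab → Encloses (suc i) ab′
    step-sound i {a , b} {a′ , b′} ok (a≤lo , hi≤b) =
      let (0≤a , ok)         = T-∧⁻ ok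
          (b≤1 , ok)         = T-∧⁻ ok
          (a′≤Hb , Ha≤b′)    = T-∧⁻ ok
          (0≤lo , lo≤hi , hi≤1) = bounds-⊆[0,1] i
          0≤hi = ≤-trans 0≤lo lo≤hi
          a≤1 = ≤-trans a≤lo (≤-trans lo≤hi hi≤1)
          0≤a′ = checked-≤ {ℚᵘ.0ℚᵘ} {a} 0≤a
          b≤1′ = checked-≤ {b} {ℚᵘ.1ℚᵘ} b≤1
      in ≤-trans (belowH?-sound {b} {a′} (≤-trans 0≤hi hi≤b) b≤1′ a′≤Hb) (H-antitone m d 0≤hi hi≤b b≤1′)
       , ≤-trans (H-antitone m d 0≤a′ a≤lo (≤-trans lo≤hi hi≤1)) (aboveH?-sound {a} {b′} 0≤a′ a≤1 Ha≤b′)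

    chain? : ℚᵘ.ℚᵘ × ℚᵘ.ℚᵘ → List (ℚᵘ.ℚᵘ × ℚᵘ.ℚᵘ) → Bool
    chain? ab []             = true
    chain? ab (ab′ ∷ chain) = step? ab ab′ ∧ chain? ab′ chain

    last : ℚᵘ.ℚᵘ × ℚᵘ.ℚᵘ → List (ℚᵘ.ℚᵘ × ℚᵘ.ℚᵘ) → ℚᵘ.ℚᵘ × ℚᵘ.ℚᵘ
    last ab []            = ab
    last ab (ab′ ∷ chain) = last ab′ chain

    chain-sound : ∀ i ab chain → T (chain? ab chain) → Encloses i ab → Encloses (length chain ℕ.+ i) (last ab chain)
    chain-sound i ab []             _  enc = enc
    chain-sound i ab (ab′ ∷ chain) ok enc =
      let (step-ok , chain-ok) = T-∧⁻ ok in
      subst (λ j → Encloses j (last ab′ chain)) (ℕ.+-suc (length chain) i)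
        (chain-sound (suc i) ab′ chain chain-ok (step-sound i {ab} {ab′} step-ok enc))

    L : ℚ
    L = 1ℚ - + 1 / 1024

    Lᵘ : ℚᵘ.ℚᵘ
    Lᵘ = ℚᵘ.1ℚᵘ ℚᵘ.- + 1 ℚᵘ./ 1024

    0≤L : 0ℚ ≤ L
    0≤L = ≤ᵇ⇒≤ tt

    -- Certifies, through H-slope, that H contracts by the factor L on [u₁ , u₂].
    contracting? : ℚᵘ.ℚᵘ → ℚᵘ.ℚᵘ → Bool
    contracting? u₁ u₂ = (ℚᵘ.0ℚᵘ ℚᵘ.≤ᵇ u₁) ∧ (u₂ ℚᵘ.≤ᵇ ℚᵘ.1ℚᵘ) ∧
      (F′-boundᵘ m d u₁ u₂ ℚᵘ.≤ᵇ Lᵘ ℚᵘ.* (1+Fᵘ u₂ ℚᵘ.* 1+Fᵘ u₂))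

    contracting?-sound : ∀ u₁ u₂ → T (contracting? u₁ u₂) →
      ∀ {p q} → fromℚᵘ u₁ ≤ p → p ≤ q → q ≤ fromℚᵘ u₂ → H m d p - H m d q ≤ L * (q - p)
    contracting?-sound u₁ u₂ ok u₁≤p p≤q q≤u₂ =
      let (0≤u₁ , ok)  = T-∧⁻ ok
          (u₂≤1 , F′≤) = T-∧⁻ ok
      in H-slope m d (checked-≤ {ℚᵘ.0ℚᵘ} {u₁} 0≤u₁) u₁≤p p≤q q≤u₂ (checked-≤ {u₂} {ℚᵘ.1ℚᵘ} u₂≤1) {L} 0≤L
           (subst₂ _≤_ (fromℚᵘ-F′-bound m d u₁ u₂) fromℚᵘ-L*[1+F]²
                       (checked-≤ {F′-boundᵘ m d u₁ u₂} {Lᵘ ℚᵘ.* (1+Fᵘ u₂ ℚᵘ.* 1+Fᵘ u₂)} F′≤))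
      where
      fromℚᵘ-L*[1+F]² :
        fromℚᵘ (Lᵘ ℚᵘ.* (1+Fᵘ u₂ ℚᵘ.* 1+Fᵘ u₂)) ≡ L * ((1ℚ + F m d (fromℚᵘ u₂)) * (1ℚ + F m d (fromℚᵘ u₂)))
      fromℚᵘ-L*[1+F]² = trans (fromℚᵘ-* Lᵘ (1+Fᵘ u₂ ℚᵘ.* 1+Fᵘ u₂))
        (cong (L *_) (trans (fromℚᵘ-* (1+Fᵘ u₂) (1+Fᵘ u₂)) (cong₂ _*_ (fromℚᵘ-1+F m d u₂) (fromℚᵘ-1+F m d u₂))))

    [0,1] : ℚᵘ.ℚᵘ × ℚᵘ.ℚᵘ
    [0,1] = ℚᵘ.0ℚᵘ , ℚᵘ.1ℚᵘ

    uniqueness? : List (ℚᵘ.ℚᵘ × ℚᵘ.ℚᵘ) → Bool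
    uniqueness? chain = chain? [0,1] chain ∧ contracting? (proj₁ (last [0,1] chain)) (proj₂ (last [0,1] chain))

    uniqueness?-sound : ∀ chain → T (uniqueness? chain) → Uniqueness (suc m) (suc d)
    uniqueness?-sound chain ok =
      let (chain-ok , contracting-ok) = T-∧⁻ ok
          (u₁≤lo , hi≤u₂) = chain-sound 0 [0,1] chain chain-ok (≤-refl , ≤-refl)
      in width→0⇒uniqueness (contraction⇒width→0 {L} (length chain ℕ.+ 0) 0≤L ([1-1/[1+t]]^k→0 1023)
                                u₁≤lo hi≤u₂ (contracting?-sound u₁ u₂ contracting-ok))
      where
      u₁ = proj₁ (last [0,1] chain)
      u₂ = proj₂ (last [0,1] chain)

    twoCycle? : ℚᵘ.ℚᵘ → ℚᵘ.ℚᵘ → Bool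
    twoCycle? b c = (ℚᵘ.0ℚᵘ ℚᵘ.≤ᵇ c) ∧ not (b ℚᵘ.≤ᵇ c) ∧ (b ℚᵘ.≤ᵇ ℚᵘ.1ℚᵘ) ∧ aboveH? c b ∧ belowH? b c

    twoCycle?-sound : ∀ b c → T (twoCycle? b c) → ¬ Uniqueness (suc m) (suc d)
    twoCycle?-sound b c ok =
      let (0≤c , ok)       = T-∧⁻ ok
          (c<b , ok)       = T-∧⁻ ok
          (b≤1 , ok)       = T-∧⁻ ok
          (Hb≤c , b≤Hc)    = T-∧⁻ ok
          0≤c′ = checked-≤ {ℚᵘ.0ℚᵘ} {c} 0≤c
          c<b′ = checked-< {c} {b} c<b
          b≤1′ = checked-≤ {b} {ℚᵘ.1ℚᵘ} b≤1
      in two-cycle⇒¬uniqueness m d 0≤c′ c<b′ b≤1′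
           (aboveH?-sound {b} {c} (≤-trans 0≤c′ (<⇒≤ c<b′)) b≤1′ Hb≤c)
           (belowH?-sound {c} {b} 0≤c′ (≤-trans (<⇒≤ c<b′) b≤1′) b≤Hc)

  module _ {C : Set} (certified? : ℕ → C → Bool) where

    allCertifiedFrom? : ℕ → List C → Bool
    allCertifiedFrom? d []       = true
    allCertifiedFrom? d (c ∷ cs) = certified? d c ∧ allCertifiedFrom? (suc d) cs

    allCertifiedFrom-lookup : ∀ {Q : ℕ → Set} → (∀ d c → T (certified? d c) → Q d) →
      ∀ d cs → T (allCertifiedFrom? d cs) → ∀ i → i ℕ.< length cs → Q (i ℕ.+ d)
    allCertifiedFrom-lookup sound d (c ∷ cs) ok zero    _           = sound d c (proj₁ (T-∧⁻ ok))
    allCertifiedFrom-lookup {Q} sound d (c ∷ cs) ok (suc i) (ℕ.s≤s i<n) =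
      subst Q (ℕ.+-suc i d) (allCertifiedFrom-lookup sound (suc d) cs (proj₂ (T-∧⁻ ok)) i i<n)

  dyadic : ℕ → ℚᵘ.ℚᵘ
  dyadic a = + a ℚᵘ./ 4294967296

  dyadic² : ℕ × ℕ → ℚᵘ.ℚᵘ × ℚᵘ.ℚᵘ
  dyadic² (a , b) = dyadic a , dyadic b

  twoCycleHigh : ℚᵘ.ℚᵘ
  twoCycleHigh = dyadic 1845493760

  -- Numerators over 2³²: the i-th chain certifies Δ = i + 2, and the i-th entry of twoCycleLows,
  -- paired with twoCycleHigh, certifies Δ = i + 29.
  uniquenessChains : List (List (ℕ × ℕ))
  uniquenessChains =
    ( (0 , 2147483648) ∷ (2113396605 , 2147483648) ∷ [] ) ∷
    ( (0 , 2147483648) ∷ (2079326736 , 2147483648) ∷ [] ) ∷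
    ( (0 , 2147483648) ∷ (2045291176 , 2147483648) ∷ [] ) ∷
    ( (0 , 2147483648) ∷ (2011306995 , 2147483648) ∷ [] ) ∷
    ( (0 , 2147483648) ∷ (1977391158 , 2147483648) ∷ [] ) ∷
    ( (0 , 2147483648) ∷ (1943560495 , 2147483648) ∷ [] ) ∷
    ( (0 , 2147483648) ∷ (1909831663 , 2147483648) ∷ [] ) ∷
    ( (0 , 2147483648) ∷ (1876221118 , 2147483648) ∷ [] ) ∷
    ( (0 , 2147483648) ∷ (1842745084 , 2147483648) ∷ [] ) ∷
    ( (0 , 2147483648) ∷ (1809419518 , 2147483648) ∷ [] ) ∷
    ( (0 , 2147483648) ∷ (1776260083 , 2147483648) ∷ (1776260083 , 2003928631) ∷ [] ) ∷
    ( (0 , 2147483648) ∷ (1743282122 , 2147483648) ∷ (1743282122 , 2004960776) ∷ [] ) ∷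
    ( (0 , 2147483648) ∷ (1710500625 , 2147483648) ∷ (1710500625 , 2007129493) ∷ [] ) ∷
    ( (0 , 2147483648) ∷ (1677930212 , 2147483648) ∷ (1677930212 , 2010240883) ∷
      (1808831840 , 2010240883) ∷ [] ) ∷
    ( (0 , 2147483648) ∷ (1645585099 , 2147483648) ∷ (1645585099 , 2014121244) ∷
      (1781606073 , 2014121244) ∷ (1781606073 , 1949015935) ∷ [] ) ∷
    ( (0 , 2147483648) ∷ (1613479085 , 2147483648) ∷ (1613479085 , 2018615702) ∷
      (1753416991 , 2018615702) ∷ (1753416991 , 1952086592) ∷ [] ) ∷
    ( (0 , 2147483648) ∷ (1581625523 , 2147483648) ∷ (1581625523 , 2023586890) ∷
      (1724297742 , 2023586890) ∷ (1724297742 , 1956613563) ∷ (1789147590 , 1956613563) ∷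
      (1789147590 , 1917944713) ∷ [] ) ∷
    ( (0 , 2147483648) ∷ (1550037307 , 2147483648) ∷ (1550037307 , 2028913666) ∷
      (1694299098 , 2028913666) ∷ (1694299098 , 1962417224) ∷ (1762907895 , 1962417224) ∷
      (1762907895 , 1921822274) ∷ [] ) ∷
    ( (0 , 2147483648) ∷ (1518726851 , 2147483648) ∷ (1518726851 , 2034489877) ∷
      (1663486948 , 2034489877) ∷ (1663486948 , 1969306878) ∷ (1734977363 , 1969306878) ∷
      (1734977363 , 1927624173) ∷ (1776316943 , 1927624173) ∷ (1776316943 , 1900216172) ∷ [] ) ∷
    ( (0 , 2147483648) ∷ (1487706075 , 2147483648) ∷ (1487706075 , 2040223167) ∷
      (1631939815 , 2040223167) ∷ (1631939815 , 1977086311) ∷ (1705369282 , 1977086311) ∷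
      (1705369282 , 1935181765) ∷ (1749598042 , 1935181765) ∷ (1749598042 , 1906252993) ∷
      (1778113713 , 1906252993) ∷ (1778113713 , 1886013210) ∷ [] ) ∷
    ( (0 , 2147483648) ∷ (1456986390 , 2147483648) ∷ (1456986390 , 2046033827) ∷
      (1599746408 , 2046033827) ∷ (1599746408 , 1985559403) ∷ (1674142094 , 1985559403) ∷
      (1674142094 , 1944275336) ∷ (1720466451 , 1944275336) ∷ (1720466451 , 1914626571) ∷
      (1751573191 , 1914626571) ∷ (1751573191 , 1892873885) ∷ (1773278798 , 1892873885) ∷
      (1773278798 , 1876772084) ∷ (1788751042 , 1876772084) ∷ (1788751042 , 1864815216) ∷ [] ) ∷
    ( (0 , 2147483648) ∷ (1426578684 , 2147483648) ∷ (1426578684 , 2051853697) ∷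
      (1567003174 , 2051853697) ∷ (1567003174 , 1994535484) ∷ (1641397484 , 1994535484) ∷
      (1641397484 , 1954643760) ∷ (1688919173 , 1954643760) ∷ (1688919173 , 1925122967) ∷
      (1721895612 , 1925122967) ∷ (1721895612 , 1902620581) ∷ (1745811159 , 1902620581) ∷
      (1745811159 , 1885208611) ∷ (1763607260 , 1885208611) ∷ (1763607260 , 1871632959) ∷
      (1777060767 , 1871632959) ∷ (1777060767 , 1861009863) ∷ (1787334463 , 1861009863) ∷
      (1787334463 , 1852684601) ∷ [] ) ∷
    ( (0 , 2147483648) ∷ (1396493319 , 2147483648) ∷ (1396493319 , 2057625104) ∷
      (1533811937 , 2057625104) ∷ (1533811937 , 2003834087) ∷ (1607276574 , 2003834087) ∷
      (1607276574 , 1965997729) ∷ (1655044171 , 1965997729) ∷ (1655044171 , 1937426690) ∷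
      (1689014303 , 1937426690) ∷ (1689014303 , 1915027792) ∷ (1714406764 , 1915027792) ∷
      (1714406764 , 1897087425) ∷ (1733973663 , 1897087425) ∷ (1733973663 , 1882534759) ∷
      (1749350097 , 1882534759) ∷ (1749350097 , 1870640206) ∷ (1761592950 , 1870640206) ∷
      (1761592950 , 1860874369) ∷ (1771428913 , 1860874369) ∷ (1771428913 , 1852835384) ∷
      (1779381120 , 1852835384) ∷ (1779381120 , 1846208469) ∷ (1785839262 , 1846208469) ∷
      (1785839262 , 1840741778) ∷ (1791101084 , 1840741778) ∷ [] ) ∷
    ( (0 , 2147483648) ∷ (1366740111 , 2147483648) ∷ (1366740111 , 2063299867) ∷
      (1500277596 , 2063299867) ∷ (1500277596 , 2013288926) ∷ (1571954234 , 2013288926) ∷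
      (1571954234 , 1978035211) ∷ (1619020490 , 1978035211) ∷ (1619020490 , 1951139921) ∷
      (1653022143 , 1951139921) ∷ (1653022143 , 1929687736) ∷ (1678976237 , 1929687736) ∷
      (1678976237 , 1912100089) ∷ (1699493564 , 1912100089) ∷ (1699493564 , 1897420385) ∷
      (1716100460 , 1897420385) ∷ (1716100460 , 1885019716) ∷ (1729766371 , 1885019716) ∷
      (1729766371 , 1874457890) ∷ (1741146796 , 1874457890) ∷ (1741146796 , 1865411152) ∷
      (1750707166 , 1865411152) ∷ (1750707166 , 1857631773) ∷ (1758791094 , 1857631773) ∷
      (1758791094 , 1850924151) ∷ (1765660332 , 1850924151) ∷ (1765660332 , 1845129980) ∷
      (1771519377 , 1845129980) ∷ (1771519377 , 1840118681) ∷ (1776531274 , 1840118681) ∷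
      (1776531274 , 1835780976) ∷ (1780828156 , 1835780976) ∷ (1780828156 , 1832024421) ∷
      (1784518512 , 1832024421) ∷ (1784518512 , 1828770193) ∷ (1787692349 , 1828770193) ∷
      (1787692349 , 1825950698) ∷ [] ) ∷
    ( (0 , 2147483648) ∷ (1337328334 , 2147483648) ∷ (1337328334 , 2068838334) ∷
      (1466505988 , 2068838334) ∷ (1466505988 , 2022750919) ∷ (1535631857 , 2022750919) ∷
      (1535631857 , 1990457413) ∷ (1581110789 , 1990457413) ∷ (1581110789 , 1965812855) ∷
      (1614180432 , 1965812855) ∷ (1614180432 , 1946039072) ∷ (1639696892 , 1946039072) ∷
      (1639696892 , 1929647867) ∷ (1660168132 , 1929647867) ∷ (1660168132 , 1915751004) ∷
      (1677045713 , 1915751004) ∷ (1677045713 , 1903776289) ∷ (1691240004 , 1903776289) ∷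
      (1691240004 , 1893333294) ∷ (1703357383 , 1893333294) ∷ (1703357383 , 1884143234) ∷
      (1713821252 , 1884143234) ∷ (1713821252 , 1875999507) ∷ (1722938753 , 1875999507) ∷
      (1722938753 , 1868744168) ∷ (1730939847 , 1868744168) ∷ (1730939847 , 1862253226) ∷
      (1738001364 , 1862253226) ∷ (1738001364 , 1856427103) ∷ (1744262407 , 1856427103) ∷
      (1744262407 , 1851184236) ∷ (1749834569 , 1851184236) ∷ (1749834569 , 1846456674) ∷
      (1754808901 , 1846456674) ∷ (1754808901 , 1842186972) ∷ (1759260794 , 1842186972) ∷
      (1759260794 , 1838325954) ∷ (1763253469 , 1838325954) ∷ (1763253469 , 1834831071) ∷
      (1766840534 , 1834831071) ∷ (1766840534 , 1831665176) ∷ (1770067879 , 1831665176) ∷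
      (1770067879 , 1828795591) ∷ (1772975111 , 1828795591) ∷ (1772975111 , 1826193389) ∷
      (1775596660 , 1826193389) ∷ (1775596660 , 1823832827) ∷ (1777962636 , 1823832827) ∷
      (1777962636 , 1821690901) ∷ (1780099511 , 1821690901) ∷ (1780099511 , 1819746980) ∷
      (1782030662 , 1819746980) ∷ (1782030662 , 1817982510) ∷ (1783776812 , 1817982510) ∷
      (1783776812 , 1816380767) ∷ (1785356391 , 1816380767) ∷ (1785356391 , 1814926648) ∷
      (1786785837 , 1814926648) ∷ (1786785837 , 1813606496) ∷ (1788079844 , 1813606496) ∷
      (1788079844 , 1812407945) ∷ [] ) ∷
    ( (0 , 2147483648) ∷ (1308266710 , 2147483648) ∷ (1308266710 , 2074208487) ∷
      (1432601903 , 2074208487) ∷ (1432601903 , 2032090206) ∷ (1498529049 , 2032090206) ∷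
      (1498529049 , 2002983540) ∷ (1541646460 , 2002983540) ∷ (1541646460 , 1980980524) ∷
      (1572907113 , 1980980524) ∷ (1572907113 , 1963424746) ∷ (1597026747 , 1963424746) ∷
      (1597026747 , 1948901376) ∷ (1616430575 , 1948901376) ∷ (1616430575 , 1936571438) ∷
      (1632515312 , 1936571438) ∷ (1632515312 , 1925898663) ∷ (1646151724 , 1925898663) ∷
      (1646151724 , 1916520621) ∷ (1657915672 , 1916520621) ∷ (1657915672 , 1908181551) ∷
      (1668205824 , 1908181551) ∷ (1668205824 , 1900694610) ∷ (1677308477 , 1900694610) ∷
      (1677308477 , 1893919370) ∷ (1685435507 , 1893919370) ∷ (1685435507 , 1887747743) ∷
      (1692747707 , 1887747743) ∷ (1692747707 , 1882094827) ∷ (1699369749 , 1882094827) ∷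
      (1699369749 , 1876892751) ∷ (1705400092 , 1876892751) ∷ (1705400092 , 1872086418) ∷
      (1710917766 , 1872086418) ∷ (1710917766 , 1867630486) ∷ (1715987108 , 1867630486) ∷
      (1715987108 , 1863487185) ∷ (1720661165 , 1863487185) ∷ (1720661165 , 1859624705) ∷
      (1724984172 , 1859624705) ∷ (1724984172 , 1856015987) ∷ (1728993398 , 1856015987) ∷
      (1728993398 , 1852637805) ∷ (1732720535 , 1852637805) ∷ (1732720535 , 1849470054) ∷
      (1736192764 , 1849470054) ∷ (1736192764 , 1846495197) ∷ (1739433579 , 1846495197) ∷
      (1739433579 , 1843697831) ∷ (1742463434 , 1843697831) ∷ (1742463434 , 1841064335) ∷
      (1745300250 , 1841064335) ∷ (1745300250 , 1838582594) ∷ (1747959832 , 1838582594) ∷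
      (1747959832 , 1836241768) ∷ (1750456191 , 1836241768) ∷ (1750456191 , 1834032111) ∷
      (1752801817 , 1834032111) ∷ (1752801817 , 1831944817) ∷ (1755007896 , 1831944817) ∷
      (1755007896 , 1829971892) ∷ (1757084493 , 1829971892) ∷ (1757084493 , 1828106051) ∷
      (1759040701 , 1828106051) ∷ (1759040701 , 1826340631) ∷ (1760884766 , 1826340631) ∷
      (1760884766 , 1824669514) ∷ (1762624196 , 1824669514) ∷ (1762624196 , 1823087064) ∷
      (1764265846 , 1823087064) ∷ (1764265846 , 1821588077) ∷ (1765815996 , 1821588077) ∷
      (1765815996 , 1820167732) ∷ (1767280415 , 1820167732) ∷ (1767280415 , 1818821552) ∷
      (1768664418 , 1818821552) ∷ (1768664418 , 1817545370) ∷ (1769972911 , 1817545370) ∷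
      (1769972911 , 1816335302) ∷ (1771210435 , 1816335302) ∷ (1771210435 , 1815187716) ∷
      (1772381202 , 1815187716) ∷ (1772381202 , 1814099215) ∷ (1773489122 , 1814099215) ∷
      (1773489122 , 1813066614) ∷ (1774537838 , 1813066614) ∷ (1774537838 , 1812086923) ∷
      (1775530743 , 1812086923) ∷ (1775530743 , 1811157333) ∷ (1776471006 , 1811157333) ∷
      (1776471006 , 1810275199) ∷ (1777361590 , 1810275199) ∷ (1777361590 , 1809438030) ∷
      (1778205269 , 1809438030) ∷ (1778205269 , 1808643477) ∷ (1779004641 , 1808643477) ∷
      (1779004641 , 1807889325) ∷ (1779762144 , 1807889325) ∷ (1779762144 , 1807173482) ∷
      (1780480068 , 1807173482) ∷ (1780480068 , 1806493970) ∷ (1781160563 , 1806493970) ∷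
      (1781160563 , 1805848921) ∷ (1781805653 , 1805848921) ∷ (1781805653 , 1805236566) ∷
      (1782417244 , 1805236566) ∷ (1782417244 , 1804655231) ∷ (1782997129 , 1804655231) ∷
      (1782997129 , 1804103332) ∷ (1783547000 , 1804103332) ∷ (1783547000 , 1803579368) ∷
      (1784068452 , 1803579368) ∷ (1784068452 , 1803081916) ∷ (1784562989 , 1803081916) ∷
      (1784562989 , 1802609629) ∷ (1785032033 , 1802609629) ∷ (1785032033 , 1802161229) ∷
      (1785476924 , 1802161229) ∷ (1785476924 , 1801735504) ∷ (1785898931 , 1801735504) ∷
      (1785898931 , 1801331305) ∷ (1786299252 , 1801331305) ∷ (1786299252 , 1800947541) ∷
      (1786679020 , 1800947541) ∷ (1786679020 , 1800583178) ∷ (1787039306 , 1800583178) ∷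
      (1787039306 , 1800237235) ∷ (1787381123 , 1800237235) ∷ (1787381123 , 1799908781) ∷ [] ) ∷
    ( (0 , 2147483648) ∷ (1279563402 , 2147483648) ∷ (1279563402 , 2079385096) ∷
      (1398667318 , 2079385096) ∷ (1398667318 , 2041197180) ∷ (1460874825 , 2041197180) ∷
      (1460874825 , 2015362915) ∷ (1501006764 , 2015362915) ∷ (1501006764 , 1996199957) ∷
      (1529743746 , 1996199957) ∷ (1529743746 , 1981167345) ∷ (1551669164 , 1981167345) ∷
      (1551669164 , 1968918813) ∷ (1569132163 , 1968918813) ∷ (1569132163 , 1958660094) ∷
      (1583480913 , 1958660094) ∷ (1583480913 , 1949886028) ∷ (1595552898 , 1949886028) ∷
      (1595552898 , 1942256905) ∷ (1605899909 , 1942256905) ∷ (1605899909 , 1935534198) ∷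
      (1614902477 , 1935534198) ∷ (1614902477 , 1929544548) ∷ (1622832773 , 1929544548) ∷
      (1622832773 , 1924158349) ∷ (1629891366 , 1924158349) ∷ (1629891366 , 1919276401) ∷
      (1636229784 , 1919276401) ∷ (1636229784 , 1914821242) ∷ (1641964949 , 1914821242) ∷
      (1641964949 , 1910731340) ∷ (1647188732 , 1910731340) ∷ (1647188732 , 1906957082) ∷
      (1651974465 , 1906957082) ∷ (1651974465 , 1903457941) ∷ (1656381493 , 1903457941) ∷
      (1656381493 , 1900200428) ∷ (1660458434 , 1900200428) ∷ (1660458434 , 1897156580) ∷
      (1664245554 , 1897156580) ∷ (1664245554 , 1894302835) ∷ (1667776526 , 1894302835) ∷
      (1667776526 , 1891619173) ∷ (1671079758 , 1891619173) ∷ (1671079758 , 1889088452) ∷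
      (1674179409 , 1889088452) ∷ (1674179409 , 1886695897) ∷ (1677096174 , 1886695897) ∷
      (1677096174 , 1884428690) ∷ (1679847896 , 1884428690) ∷ (1679847896 , 1882275648) ∷
      (1682450055 , 1882275648) ∷ (1682450055 , 1880226961) ∷ (1684916158 , 1880226961) ∷
      (1684916158 , 1878273981) ∷ (1687258049 , 1878273981) ∷ (1687258049 , 1876409052) ∷
      (1689486163 , 1876409052) ∷ (1689486163 , 1874625364) ∷ (1691609737 , 1874625364) ∷
      (1691609737 , 1872916838) ∷ (1693636982 , 1872916838) ∷ (1693636982 , 1871278026) ∷
      (1695575223 , 1871278026) ∷ (1695575223 , 1869704029) ∷ (1697431020 , 1869704029) ∷
      (1697431020 , 1868190427) ∷ (1699210267 , 1868190427) ∷ (1699210267 , 1866733222) ∷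
      (1700918279 , 1866733222) ∷ (1700918279 , 1865328784) ∷ (1702559860 , 1865328784) ∷
      (1702559860 , 1863973810) ∷ (1704139367 , 1863973810) ∷ (1704139367 , 1862665286) ∷
      (1705660762 , 1862665286) ∷ (1705660762 , 1861400457) ∷ (1707127656 , 1861400457) ∷
      (1707127656 , 1860176797) ∷ (1708543348 , 1860176797) ∷ (1708543348 , 1858991984) ∷
      (1709910860 , 1858991984) ∷ (1709910860 , 1857843882) ∷ (1711232968 , 1857843882) ∷
      (1711232968 , 1856730519) ∷ (1712512222 , 1856730519) ∷ (1712512222 , 1855650074) ∷
      (1713750974 , 1855650074) ∷ (1713750974 , 1854600861) ∷ (1714951394 , 1854600861) ∷
      (1714951394 , 1853581315) ∷ (1716115492 , 1853581315) ∷ (1716115492 , 1852589983) ∷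
      (1717245128 , 1852589983) ∷ (1717245128 , 1851625513) ∷ (1718342031 , 1851625513) ∷
      (1718342031 , 1850686644) ∷ (1719407806 , 1850686644) ∷ (1719407806 , 1849772200) ∷
      (1720443949 , 1849772200) ∷ (1720443949 , 1848881083) ∷ (1721451853 , 1848881083) ∷
      (1721451853 , 1848012263) ∷ (1722432821 , 1848012263) ∷ (1722432821 , 1847164777) ∷
      (1723388070 , 1847164777) ∷ (1723388070 , 1846337721) ∷ (1724318739 , 1846337721) ∷
      (1724318739 , 1845530245) ∷ (1725225897 , 1845530245) ∷ (1725225897 , 1844741551) ∷
      (1726110545 , 1844741551) ∷ (1726110545 , 1843970887) ∷ (1726973626 , 1843970887) ∷
      (1726973626 , 1843217544) ∷ (1727816026 , 1843217544) ∷ (1727816026 , 1842480853) ∷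
      (1728638579 , 1842480853) ∷ (1728638579 , 1841760184) ∷ (1729442071 , 1841760184) ∷
      (1729442071 , 1841054939) ∷ (1730227246 , 1841054939) ∷ (1730227246 , 1840364553) ∷
      (1730994803 , 1840364553) ∷ (1730994803 , 1839688492) ∷ (1731745405 , 1839688492) ∷
      (1731745405 , 1839026249) ∷ (1732479680 , 1839026249) ∷ (1732479680 , 1838377342) ∷
      (1733198221 , 1838377342) ∷ (1733198221 , 1837741316) ∷ (1733901591 , 1837741316) ∷
      (1733901591 , 1837117736) ∷ (1734590324 , 1837117736) ∷ (1734590324 , 1836506190) ∷
      (1735264928 , 1836506190) ∷ (1735264928 , 1835906284) ∷ (1735925885 , 1835906284) ∷
      (1735925885 , 1835317645) ∷ (1736573652 , 1835317645) ∷ (1736573652 , 1834739917) ∷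
      (1737208666 , 1834739917) ∷ (1737208666 , 1834172759) ∷ (1737831342 , 1834172759) ∷
      (1737831342 , 1833615848) ∷ (1738442075 , 1833615848) ∷ (1738442075 , 1833068873) ∷
      (1739041244 , 1833068873) ∷ (1739041244 , 1832531538) ∷ (1739629209 , 1832531538) ∷
      (1739629209 , 1832003560) ∷ (1740206314 , 1832003560) ∷ (1740206314 , 1831484667) ∷
      (1740772888 , 1831484667) ∷ (1740772888 , 1830974601) ∷ (1741329244 , 1830974601) ∷
      (1741329244 , 1830473114) ∷ (1741875683 , 1830473114) ∷ (1741875683 , 1829979967) ∷
      (1742412494 , 1829979967) ∷ (1742412494 , 1829494932) ∷ (1742939951 , 1829494932) ∷
      (1742939951 , 1829017789) ∷ (1743458320 , 1829017789) ∷ (1743458320 , 1828548329) ∷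
      (1743967853 , 1828548329) ∷ (1743967853 , 1828086349) ∷ (1744468793 , 1828086349) ∷
      (1744468793 , 1827631656) ∷ (1744961374 , 1827631656) ∷ (1744961374 , 1827184062) ∷
      (1745445820 , 1827184062) ∷ (1745445820 , 1826743387) ∷ (1745922346 , 1826743387) ∷
      (1745922346 , 1826309460) ∷ (1746391159 , 1826309460) ∷ (1746391159 , 1825882114) ∷
      (1746852458 , 1825882114) ∷ (1746852458 , 1825461188) ∷ (1747306434 , 1825461188) ∷
      (1747306434 , 1825046528) ∷ (1747753272 , 1825046528) ∷ (1747753272 , 1824637985) ∷
      (1748193149 , 1824637985) ∷ (1748193149 , 1824235416) ∷ (1748626237 , 1824235416) ∷
      (1748626237 , 1823838682) ∷ (1749052699 , 1823838682) ∷ (1749052699 , 1823447649) ∷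
      (1749472696 , 1823447649) ∷ (1749472696 , 1823062188) ∷ (1749886380 , 1823062188) ∷
      (1749886380 , 1822682174) ∷ (1750293900 , 1822682174) ∷ (1750293900 , 1822307487) ∷
      (1750695397 , 1822307487) ∷ (1750695397 , 1821938011) ∷ (1751091011 , 1821938011) ∷
      (1751091011 , 1821573631) ∷ (1751480875 , 1821573631) ∷ (1751480875 , 1821214240) ∷
      (1751865117 , 1821214240) ∷ (1751865117 , 1820859732) ∷ (1752243862 , 1820859732) ∷
      (1752243862 , 1820510004) ∷ (1752617231 , 1820510004) ∷ (1752617231 , 1820164958) ∷
      (1752985340 , 1820164958) ∷ (1752985340 , 1819824497) ∷ (1753348302 , 1819824497) ∷
      (1753348302 , 1819488530) ∷ (1753706226 , 1819488530) ∷ (1753706226 , 1819156965) ∷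
      (1754059219 , 1819156965) ∷ (1754059219 , 1818829715) ∷ (1754407382 , 1818829715) ∷
      (1754407382 , 1818506696) ∷ (1754750816 , 1818506696) ∷ (1754750816 , 1818187824) ∷
      (1755089617 , 1818187824) ∷ (1755089617 , 1817873021) ∷ (1755423878 , 1817873021) ∷
      (1755423878 , 1817562208) ∷ (1755753690 , 1817562208) ∷ (1755753690 , 1817255311) ∷
      (1756079141 , 1817255311) ∷ (1756079141 , 1816952256) ∷ (1756400316 , 1816952256) ∷
      (1756400316 , 1816652973) ∷ (1756717297 , 1816652973) ∷ (1756717297 , 1816357392) ∷
      (1757030167 , 1816357392) ∷ (1757030167 , 1816065446) ∷ (1757339002 , 1816065446) ∷
      (1757339002 , 1815777070) ∷ (1757643879 , 1815777070) ∷ (1757643879 , 1815492200) ∷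
      (1757944872 , 1815492200) ∷ (1757944872 , 1815210774) ∷ (1758242053 , 1815210774) ∷
      (1758242053 , 1814932732) ∷ (1758535492 , 1814932732) ∷ (1758535492 , 1814658014) ∷
      (1758825257 , 1814658014) ∷ (1758825257 , 1814386565) ∷ (1759111414 , 1814386565) ∷
      (1759111414 , 1814118329) ∷ (1759394027 , 1814118329) ∷ (1759394027 , 1813853251) ∷
      (1759673159 , 1813853251) ∷ (1759673159 , 1813591278) ∷ (1759948872 , 1813591278) ∷
      (1759948872 , 1813332359) ∷ (1760221224 , 1813332359) ∷ (1760221224 , 1813076444) ∷
      (1760490274 , 1813076444) ∷ (1760490274 , 1812823484) ∷ (1760756078 , 1812823484) ∷
      (1760756078 , 1812573430) ∷ (1761018691 , 1812573430) ∷ (1761018691 , 1812326238) ∷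
      (1761278166 , 1812326238) ∷ (1761278166 , 1812081861) ∷ (1761534557 , 1812081861) ∷
      (1761534557 , 1811840253) ∷ (1761787915 , 1811840253) ∷ (1761787915 , 1811601372) ∷
      (1762038289 , 1811601372) ∷ (1762038289 , 1811365176) ∷ (1762285727 , 1811365176) ∷
      (1762285727 , 1811131624) ∷ (1762530278 , 1811131624) ∷ (1762530278 , 1810900675) ∷
      (1762771986 , 1810900675) ∷ (1762771986 , 1810672290) ∷ (1763010898 , 1810672290) ∷
      (1763010898 , 1810446430) ∷ (1763247057 , 1810446430) ∷ (1763247057 , 1810223057) ∷
      (1763480508 , 1810223057) ∷ (1763480508 , 1810002134) ∷ (1763711292 , 1810002134) ∷
      (1763711292 , 1809783626) ∷ (1763939450 , 1809783626) ∷ (1763939450 , 1809567497) ∷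
      (1764165022 , 1809567497) ∷ (1764165022 , 1809353712) ∷ (1764388049 , 1809353712) ∷
      (1764388049 , 1809142238) ∷ (1764608568 , 1809142238) ∷ (1764608568 , 1808933041) ∷
      (1764826617 , 1808933041) ∷ (1764826617 , 1808726090) ∷ (1765042233 , 1808726090) ∷
      (1765042233 , 1808521352) ∷ (1765255452 , 1808521352) ∷ (1765255452 , 1808318796) ∷
      (1765466309 , 1808318796) ∷ (1765466309 , 1808118393) ∷ (1765674839 , 1808118393) ∷
      (1765674839 , 1807920112) ∷ (1765881075 , 1807920112) ∷ (1765881075 , 1807723924) ∷
      (1766085051 , 1807723924) ∷ (1766085051 , 1807529801) ∷ (1766286798 , 1807529801) ∷
      (1766286798 , 1807337715) ∷ (1766486348 , 1807337715) ∷ (1766486348 , 1807147638) ∷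
      (1766683733 , 1807147638) ∷ (1766683733 , 1806959544) ∷ (1766878983 , 1806959544) ∷
      (1766878983 , 1806773405) ∷ (1767072127 , 1806773405) ∷ (1767072127 , 1806589197) ∷
      (1767263195 , 1806589197) ∷ (1767263195 , 1806406893) ∷ (1767452216 , 1806406893) ∷
      (1767452216 , 1806226469) ∷ (1767639218 , 1806226469) ∷ (1767639218 , 1806047900) ∷
      (1767824228 , 1806047900) ∷ (1767824228 , 1805871162) ∷ (1768007273 , 1805871162) ∷
      (1768007273 , 1805696232) ∷ (1768188380 , 1805696232) ∷ (1768188380 , 1805523087) ∷
      (1768367574 , 1805523087) ∷ (1768367574 , 1805351703) ∷ (1768544882 , 1805351703) ∷
      (1768544882 , 1805182059) ∷ (1768720327 , 1805182059) ∷ (1768720327 , 1805014134) ∷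
      (1768893934 , 1805014134) ∷ (1768893934 , 1804847905) ∷ (1769065728 , 1804847905) ∷
      (1769065728 , 1804683351) ∷ (1769235733 , 1804683351) ∷ (1769235733 , 1804520451) ∷
      (1769403971 , 1804520451) ∷ (1769403971 , 1804359186) ∷ (1769570465 , 1804359186) ∷
      (1769570465 , 1804199535) ∷ (1769735237 , 1804199535) ∷ (1769735237 , 1804041479) ∷
      (1769898309 , 1804041479) ∷ (1769898309 , 1803884999) ∷ (1770059703 , 1803884999) ∷
      (1770059703 , 1803730074) ∷ (1770219441 , 1803730074) ∷ (1770219441 , 1803576687) ∷
      (1770377542 , 1803576687) ∷ (1770377542 , 1803424820) ∷ (1770534027 , 1803424820) ∷
      (1770534027 , 1803274454) ∷ (1770688917 , 1803274454) ∷ (1770688917 , 1803125571) ∷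
      (1770842232 , 1803125571) ∷ (1770842232 , 1802978153) ∷ (1770993990 , 1802978153) ∷
      (1770993990 , 1802832185) ∷ (1771144211 , 1802832185) ∷ (1771144211 , 1802687648) ∷
      (1771292913 , 1802687648) ∷ (1771292913 , 1802544527) ∷ (1771440115 , 1802544527) ∷
      (1771440115 , 1802402804) ∷ (1771585836 , 1802402804) ∷ (1771585836 , 1802262464) ∷
      (1771730092 , 1802262464) ∷ (1771730092 , 1802123491) ∷ (1771872902 , 1802123491) ∷
      (1771872902 , 1801985869) ∷ (1772014282 , 1801985869) ∷ (1772014282 , 1801849583) ∷
      (1772154251 , 1801849583) ∷ (1772154251 , 1801714617) ∷ (1772292824 , 1801714617) ∷
      (1772292824 , 1801580957) ∷ (1772430018 , 1801580957) ∷ (1772430018 , 1801448588) ∷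
      (1772565849 , 1801448588) ∷ (1772565849 , 1801317496) ∷ (1772700333 , 1801317496) ∷
      (1772700333 , 1801187666) ∷ (1772833486 , 1801187666) ∷ (1772833486 , 1801059084) ∷
      (1772965323 , 1801059084) ∷ (1772965323 , 1800931737) ∷ (1773095859 , 1800931737) ∷
      (1773095859 , 1800805612) ∷ (1773225109 , 1800805612) ∷ (1773225109 , 1800680694) ∷
      (1773353088 , 1800680694) ∷ (1773353088 , 1800556970) ∷ (1773479811 , 1800556970) ∷
      (1773479811 , 1800434427) ∷ (1773605292 , 1800434427) ∷ (1773605292 , 1800313053) ∷
      (1773729545 , 1800313053) ∷ (1773729545 , 1800192834) ∷ (1773852584 , 1800192834) ∷
      (1773852584 , 1800073758) ∷ (1773974423 , 1800073758) ∷ (1773974423 , 1799955813) ∷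
      (1774095075 , 1799955813) ∷ (1774095075 , 1799838987) ∷ (1774214552 , 1799838987) ∷
      (1774214552 , 1799723268) ∷ (1774332869 , 1799723268) ∷ (1774332869 , 1799608644) ∷
      (1774450038 , 1799608644) ∷ (1774450038 , 1799495104) ∷ (1774566072 , 1799495104) ∷
      (1774566072 , 1799382635) ∷ (1774680984 , 1799382635) ∷ (1774680984 , 1799271226) ∷
      (1774794786 , 1799271226) ∷ (1774794786 , 1799160867) ∷ (1774907489 , 1799160867) ∷
      (1774907489 , 1799051547) ∷ (1775019106 , 1799051547) ∷ (1775019106 , 1798943254) ∷
      (1775129649 , 1798943254) ∷ (1775129649 , 1798835978) ∷ (1775239129 , 1798835978) ∷
      (1775239129 , 1798729708) ∷ (1775347559 , 1798729708) ∷ (1775347559 , 1798624433) ∷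
      (1775454949 , 1798624433) ∷ (1775454949 , 1798520144) ∷ (1775561311 , 1798520144) ∷
      (1775561311 , 1798416830) ∷ (1775666655 , 1798416830) ∷ (1775666655 , 1798314481) ∷
      (1775770992 , 1798314481) ∷ (1775770992 , 1798213088) ∷ (1775874333 , 1798213088) ∷
      (1775874333 , 1798112640) ∷ (1775976690 , 1798112640) ∷ (1775976690 , 1798013128) ∷
      (1776078071 , 1798013128) ∷ (1776078071 , 1797914542) ∷ (1776178488 , 1797914542) ∷
      (1776178488 , 1797816873) ∷ (1776277951 , 1797816873) ∷ (1776277951 , 1797720111) ∷
      (1776376470 , 1797720111) ∷ (1776376470 , 1797624248) ∷ (1776474054 , 1797624248) ∷
      (1776474054 , 1797529274) ∷ (1776570714 , 1797529274) ∷ (1776570714 , 1797435180) ∷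
      (1776666459 , 1797435180) ∷ (1776666459 , 1797341957) ∷ (1776761299 , 1797341957) ∷
      (1776761299 , 1797249597) ∷ (1776855243 , 1797249597) ∷ (1776855243 , 1797158091) ∷
      (1776948301 , 1797158091) ∷ (1776948301 , 1797067430) ∷ (1777040481 , 1797067430) ∷
      (1777040481 , 1796977607) ∷ (1777131793 , 1796977607) ∷ (1777131793 , 1796888612) ∷
      (1777222245 , 1796888612) ∷ (1777222245 , 1796800438) ∷ (1777311847 , 1796800438) ∷
      (1777311847 , 1796713076) ∷ (1777400607 , 1796713076) ∷ (1777400607 , 1796626519) ∷
      (1777488533 , 1796626519) ∷ (1777488533 , 1796540758) ∷ (1777575635 , 1796540758) ∷
      (1777575635 , 1796455786) ∷ (1777661920 , 1796455786) ∷ (1777661920 , 1796371594) ∷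
      (1777747398 , 1796371594) ∷ (1777747398 , 1796288175) ∷ (1777832077 , 1796288175) ∷
      (1777832077 , 1796205521) ∷ (1777915964 , 1796205521) ∷ (1777915964 , 1796123625) ∷
      (1777999067 , 1796123625) ∷ (1777999067 , 1796042481) ∷ (1778081394 , 1796042481) ∷
      (1778081394 , 1795962079) ∷ (1778162953 , 1795962079) ∷ (1778162953 , 1795882414) ∷
      (1778243752 , 1795882414) ∷ (1778243752 , 1795803477) ∷ (1778323799 , 1795803477) ∷
      (1778323799 , 1795725262) ∷ (1778403101 , 1795725262) ∷ (1778403101 , 1795647762) ∷
      (1778481665 , 1795647762) ∷ (1778481665 , 1795570970) ∷ (1778559498 , 1795570970) ∷
      (1778559498 , 1795494879) ∷ (1778636609 , 1795494879) ∷ (1778636609 , 1795419482) ∷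
      (1778713004 , 1795419482) ∷ (1778713004 , 1795344773) ∷ (1778788690 , 1795344773) ∷
      (1778788690 , 1795270746) ∷ (1778863674 , 1795270746) ∷ (1778863674 , 1795197393) ∷
      (1778937964 , 1795197393) ∷ (1778937964 , 1795124707) ∷ (1779011566 , 1795124707) ∷
      (1779011566 , 1795052684) ∷ (1779084487 , 1795052684) ∷ (1779084487 , 1794981315) ∷
      (1779156734 , 1794981315) ∷ (1779156734 , 1794910595) ∷ (1779228313 , 1794910595) ∷
      (1779228313 , 1794840519) ∷ (1779299231 , 1794840519) ∷ (1779299231 , 1794771079) ∷
      (1779369494 , 1794771079) ∷ (1779369494 , 1794702270) ∷ (1779439109 , 1794702270) ∷
      (1779439109 , 1794634085) ∷ (1779508082 , 1794634085) ∷ (1779508082 , 1794566520) ∷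
      (1779576419 , 1794566520) ∷ (1779576419 , 1794499567) ∷ (1779644127 , 1794499567) ∷
      (1779644127 , 1794433222) ∷ (1779711211 , 1794433222) ∷ (1779711211 , 1794367478) ∷
      (1779777678 , 1794367478) ∷ (1779777678 , 1794302329) ∷ (1779843534 , 1794302329) ∷
      (1779843534 , 1794237771) ∷ (1779908785 , 1794237771) ∷ (1779908785 , 1794173797) ∷
      (1779973436 , 1794173797) ∷ (1779973436 , 1794110402) ∷ (1780037493 , 1794110402) ∷
      (1780037493 , 1794047581) ∷ (1780100962 , 1794047581) ∷ (1780100962 , 1793985328) ∷
      (1780163849 , 1793985328) ∷ (1780163849 , 1793923638) ∷ (1780226159 , 1793923638) ∷
      (1780226159 , 1793862505) ∷ (1780287898 , 1793862505) ∷ (1780287898 , 1793801925) ∷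
      (1780349072 , 1793801925) ∷ (1780349072 , 1793741891) ∷ (1780409686 , 1793741891) ∷
      (1780409686 , 1793682400) ∷ (1780469744 , 1793682400) ∷ (1780469744 , 1793623446) ∷
      (1780529253 , 1793623446) ∷ (1780529253 , 1793565024) ∷ (1780588218 , 1793565024) ∷
      (1780588218 , 1793507128) ∷ (1780646644 , 1793507128) ∷ (1780646644 , 1793449755) ∷
      (1780704536 , 1793449755) ∷ (1780704536 , 1793392899) ∷ (1780761899 , 1793392899) ∷
      (1780761899 , 1793336556) ∷ (1780818738 , 1793336556) ∷ (1780818738 , 1793280720) ∷
      (1780875059 , 1793280720) ∷ (1780875059 , 1793225387) ∷ (1780930865 , 1793225387) ∷
      (1780930865 , 1793170553) ∷ (1780986163 , 1793170553) ∷ (1780986163 , 1793116212) ∷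
      (1781040956 , 1793116212) ∷ (1781040956 , 1793062361) ∷ (1781095250 , 1793062361) ∷
      (1781095250 , 1793008994) ∷ (1781149049 , 1793008994) ∷ (1781149049 , 1792956108) ∷
      (1781202358 , 1792956108) ∷ (1781202358 , 1792903697) ∷ (1781255182 , 1792903697) ∷
      (1781255182 , 1792851758) ∷ (1781307524 , 1792851758) ∷ (1781307524 , 1792800286) ∷
      (1781359390 , 1792800286) ∷ (1781359390 , 1792749277) ∷ (1781410785 , 1792749277) ∷
      (1781410785 , 1792698726) ∷ (1781461712 , 1792698726) ∷ (1781461712 , 1792648629) ∷
      (1781512176 , 1792648629) ∷ (1781512176 , 1792598983) ∷ (1781562181 , 1792598983) ∷
      (1781562181 , 1792549783) ∷ (1781611732 , 1792549783) ∷ (1781611732 , 1792501024) ∷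
      (1781660833 , 1792501024) ∷ (1781660833 , 1792452703) ∷ (1781709489 , 1792452703) ∷
      (1781709489 , 1792404815) ∷ (1781757703 , 1792404815) ∷ (1781757703 , 1792357357) ∷
      (1781805480 , 1792357357) ∷ (1781805480 , 1792310325) ∷ (1781852823 , 1792310325) ∷
      (1781852823 , 1792263715) ∷ (1781899737 , 1792263715) ∷ (1781899737 , 1792217523) ∷
      (1781946225 , 1792217523) ∷ (1781946225 , 1792171746) ∷ (1781992292 , 1792171746) ∷
      (1781992292 , 1792126379) ∷ (1782037941 , 1792126379) ∷ (1782037941 , 1792081419) ∷
      (1782083177 , 1792081419) ∷ (1782083177 , 1792036862) ∷ (1782128003 , 1792036862) ∷
      (1782128003 , 1791992704) ∷ (1782172423 , 1791992704) ∷ (1782172423 , 1791948942) ∷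
      (1782216441 , 1791948942) ∷ (1782216441 , 1791905572) ∷ (1782260061 , 1791905572) ∷
      (1782260061 , 1791862590) ∷ (1782303286 , 1791862590) ∷ (1782303286 , 1791819993) ∷
      (1782346121 , 1791819993) ∷ (1782346121 , 1791777777) ∷ (1782388568 , 1791777777) ∷
      (1782388568 , 1791735940) ∷ (1782430631 , 1791735940) ∷ (1782430631 , 1791694477) ∷
      (1782472314 , 1791694477) ∷ (1782472314 , 1791653385) ∷ (1782513621 , 1791653385) ∷
      (1782513621 , 1791612661) ∷ (1782554554 , 1791612661) ∷ (1782554554 , 1791572301) ∷
      (1782595117 , 1791572301) ∷ (1782595117 , 1791532303) ∷ (1782635314 , 1791532303) ∷
      (1782635314 , 1791492662) ∷ (1782675148 , 1791492662) ∷ (1782675148 , 1791453377) ∷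
      (1782714622 , 1791453377) ∷ (1782714622 , 1791414442) ∷ (1782753740 , 1791414442) ∷
      (1782753740 , 1791375856) ∷ (1782792505 , 1791375856) ∷ (1782792505 , 1791337615) ∷
      (1782830920 , 1791337615) ∷ (1782830920 , 1791299716) ∷ (1782868988 , 1791299716) ∷
      (1782868988 , 1791262156) ∷ (1782906713 , 1791262156) ∷ (1782906713 , 1791224931) ∷
      (1782944098 , 1791224931) ∷ (1782944098 , 1791188040) ∷ (1782981146 , 1791188040) ∷
      (1782981146 , 1791151477) ∷ (1783017860 , 1791151477) ∷ (1783017860 , 1791115242) ∷
      (1783054243 , 1791115242) ∷ (1783054243 , 1791079331) ∷ (1783090298 , 1791079331) ∷
      (1783090298 , 1791043740) ∷ (1783126029 , 1791043740) ∷ (1783126029 , 1791008467) ∷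
      (1783161437 , 1791008467) ∷ (1783161437 , 1790973510) ∷ (1783196526 , 1790973510) ∷
      (1783196526 , 1790938865) ∷ (1783231300 , 1790938865) ∷ (1783231300 , 1790904529) ∷
      (1783265760 , 1790904529) ∷ (1783265760 , 1790870500) ∷ (1783299910 , 1790870500) ∷
      (1783299910 , 1790836775) ∷ (1783333753 , 1790836775) ∷ (1783333753 , 1790803351) ∷
      (1783367291 , 1790803351) ∷ (1783367291 , 1790770225) ∷ (1783400528 , 1790770225) ∷
      (1783400528 , 1790737395) ∷ (1783433465 , 1790737395) ∷ (1783433465 , 1790704858) ∷
      (1783466107 , 1790704858) ∷ (1783466107 , 1790672611) ∷ (1783498455 , 1790672611) ∷
      (1783498455 , 1790640652) ∷ (1783530512 , 1790640652) ∷ (1783530512 , 1790608979) ∷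
      (1783562280 , 1790608979) ∷ (1783562280 , 1790577588) ∷ (1783593763 , 1790577588) ∷
      (1783593763 , 1790546478) ∷ (1783624962 , 1790546478) ∷ (1783624962 , 1790515645) ∷
      (1783655882 , 1790515645) ∷ (1783655882 , 1790485087) ∷ (1783686524 , 1790485087) ∷
      (1783686524 , 1790454801) ∷ (1783716891 , 1790454801) ∷ (1783716891 , 1790424786) ∷
      (1783746984 , 1790424786) ∷ (1783746984 , 1790395039) ∷ (1783776807 , 1790395039) ∷
      (1783776807 , 1790365557) ∷ (1783806362 , 1790365557) ∷ (1783806362 , 1790336338) ∷
      (1783835652 , 1790336338) ∷ (1783835652 , 1790307380) ∷ (1783864678 , 1790307380) ∷
      (1783864678 , 1790278680) ∷ (1783893444 , 1790278680) ∷ (1783893444 , 1790250236) ∷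
      (1783921952 , 1790250236) ∷ (1783921952 , 1790222046) ∷ (1783950204 , 1790222046) ∷
      (1783950204 , 1790194107) ∷ (1783978202 , 1790194107) ∷ (1783978202 , 1790166417) ∷
      (1784005949 , 1790166417) ∷ (1784005949 , 1790138974) ∷ (1784033447 , 1790138974) ∷
      (1784033447 , 1790111776) ∷ (1784060698 , 1790111776) ∷ (1784060698 , 1790084820) ∷
      (1784087705 , 1790084820) ∷ (1784087705 , 1790058104) ∷ (1784114470 , 1790058104) ∷
      (1784114470 , 1790031627) ∷ (1784140994 , 1790031627) ∷ (1784140994 , 1790005386) ∷
      (1784167280 , 1790005386) ∷ (1784167280 , 1789979379) ∷ (1784193330 , 1789979379) ∷
      (1784193330 , 1789953604) ∷ (1784219147 , 1789953604) ∷ (1784219147 , 1789928058) ∷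
      (1784244733 , 1789928058) ∷ (1784244733 , 1789902740) ∷ (1784270089 , 1789902740) ∷
      (1784270089 , 1789877647) ∷ (1784295218 , 1789877647) ∷ (1784295218 , 1789852778) ∷
      (1784320122 , 1789852778) ∷ (1784320122 , 1789828131) ∷ (1784344802 , 1789828131) ∷
      (1784344802 , 1789803704) ∷ (1784369261 , 1789803704) ∷ (1784369261 , 1789779494) ∷
      (1784393501 , 1789779494) ∷ (1784393501 , 1789755500) ∷ (1784417524 , 1789755500) ∷
      (1784417524 , 1789731719) ∷ (1784441332 , 1789731719) ∷ (1784441332 , 1789708150) ∷
      (1784464926 , 1789708150) ∷ (1784464926 , 1789684792) ∷ (1784488309 , 1789684792) ∷
      (1784488309 , 1789661641) ∷ (1784511483 , 1789661641) ∷ (1784511483 , 1789638697) ∷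
      (1784534448 , 1789638697) ∷ (1784534448 , 1789615958) ∷ (1784557208 , 1789615958) ∷
      (1784557208 , 1789593421) ∷ (1784579764 , 1789593421) ∷ (1784579764 , 1789571084) ∷
      (1784602119 , 1789571084) ∷ (1784602119 , 1789548946) ∷ (1784624273 , 1789548946) ∷
      (1784624273 , 1789527006) ∷ (1784646229 , 1789527006) ∷ (1784646229 , 1789505261) ∷
      (1784667988 , 1789505261) ∷ (1784667988 , 1789483710) ∷ (1784689553 , 1789483710) ∷
      (1784689553 , 1789462350) ∷ (1784710925 , 1789462350) ∷ (1784710925 , 1789441181) ∷
      (1784732105 , 1789441181) ∷ (1784732105 , 1789420201) ∷ (1784753095 , 1789420201) ∷
      (1784753095 , 1789399408) ∷ (1784773897 , 1789399408) ∷ (1784773897 , 1789378800) ∷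
      (1784794513 , 1789378800) ∷ (1784794513 , 1789358375) ∷ (1784814945 , 1789358375) ∷
      (1784814945 , 1789338133) ∷ (1784835194 , 1789338133) ∷ (1784835194 , 1789318070) ∷
      (1784855262 , 1789318070) ∷ (1784855262 , 1789298186) ∷ (1784875150 , 1789298186) ∷
      (1784875150 , 1789278479) ∷ (1784894861 , 1789278479) ∷ (1784894861 , 1789258948) ∷
      (1784914395 , 1789258948) ∷ (1784914395 , 1789239590) ∷ (1784933755 , 1789239590) ∷
      (1784933755 , 1789220404) ∷ (1784952942 , 1789220404) ∷ (1784952942 , 1789201389) ∷
      (1784971957 , 1789201389) ∷ (1784971957 , 1789182544) ∷ (1784990802 , 1789182544) ∷
      (1784990802 , 1789163866) ∷ (1785009478 , 1789163866) ∷ (1785009478 , 1789145356) ∷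
      (1785027986 , 1789145356) ∷ (1785027986 , 1789127011) ∷ (1785046329 , 1789127011) ∷
      (1785046329 , 1789108828) ∷ (1785064509 , 1789108828) ∷ (1785064509 , 1789090807) ∷
      (1785082526 , 1789090807) ∷ (1785082526 , 1789072946) ∷ (1785100382 , 1789072946) ∷
      (1785100382 , 1789055245) ∷ (1785118078 , 1789055245) ∷ (1785118078 , 1789037701) ∷
      (1785135616 , 1789037701) ∷ (1785135616 , 1789020314) ∷ (1785152997 , 1789020314) ∷
      (1785152997 , 1789003081) ∷ (1785170223 , 1789003081) ∷ (1785170223 , 1788986002) ∷
      (1785187294 , 1788986002) ∷ (1785187294 , 1788969075) ∷ (1785204213 , 1788969075) ∷
      (1785204213 , 1788952299) ∷ (1785220981 , 1788952299) ∷ (1785220981 , 1788935672) ∷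
      (1785237599 , 1788935672) ∷ (1785237599 , 1788919193) ∷ (1785254068 , 1788919193) ∷
      (1785254068 , 1788902861) ∷ (1785270390 , 1788902861) ∷ (1785270390 , 1788886674) ∷
      (1785286567 , 1788886674) ∷ (1785286567 , 1788870631) ∷ (1785302599 , 1788870631) ∷
      (1785302599 , 1788854731) ∷ (1785318487 , 1788854731) ∷ (1785318487 , 1788838973) ∷
      (1785334233 , 1788838973) ∷ (1785334233 , 1788823355) ∷ (1785349839 , 1788823355) ∷
      (1785349839 , 1788807876) ∷ (1785365306 , 1788807876) ∷ (1785365306 , 1788792534) ∷
      (1785380635 , 1788792534) ∷ (1785380635 , 1788777329) ∷ (1785395826 , 1788777329) ∷
      (1785395826 , 1788762260) ∷ (1785410881 , 1788762260) ∷ (1785410881 , 1788747325) ∷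
      (1785425802 , 1788747325) ∷ (1785425802 , 1788732523) ∷ (1785440590 , 1788732523) ∷
      (1785440590 , 1788717852) ∷ (1785455246 , 1788717852) ∷ (1785455246 , 1788703312) ∷
      (1785469771 , 1788703312) ∷ (1785469771 , 1788688901) ∷ (1785484167 , 1788688901) ∷
      (1785484167 , 1788674618) ∷ (1785498434 , 1788674618) ∷ (1785498434 , 1788660463) ∷
      (1785512573 , 1788660463) ∷ (1785512573 , 1788646434) ∷ (1785526586 , 1788646434) ∷
      (1785526586 , 1788632529) ∷ (1785540474 , 1788632529) ∷ (1785540474 , 1788618749) ∷
      (1785554237 , 1788618749) ∷ (1785554237 , 1788605091) ∷ (1785567878 , 1788605091) ∷
      (1785567878 , 1788591555) ∷ (1785581397 , 1788591555) ∷ (1785581397 , 1788578139) ∷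
      (1785594796 , 1788578139) ∷ (1785594796 , 1788564842) ∷ (1785608075 , 1788564842) ∷
      (1785608075 , 1788551664) ∷ (1785621235 , 1788551664) ∷ (1785621235 , 1788538603) ∷
      (1785634278 , 1788538603) ∷ (1785634278 , 1788525658) ∷ (1785647205 , 1788525658) ∷
      (1785647205 , 1788512828) ∷ (1785660016 , 1788512828) ∷ (1785660016 , 1788500113) ∷
      (1785672713 , 1788500113) ∷ (1785672713 , 1788487511) ∷ (1785685296 , 1788487511) ∷
      (1785685296 , 1788475021) ∷ (1785697767 , 1788475021) ∷ (1785697767 , 1788462642) ∷
      (1785710127 , 1788462642) ∷ (1785710127 , 1788450373) ∷ (1785722376 , 1788450373) ∷
      (1785722376 , 1788438214) ∷ (1785734516 , 1788438214) ∷ (1785734516 , 1788426163) ∷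
      (1785746547 , 1788426163) ∷ (1785746547 , 1788414219) ∷ (1785758472 , 1788414219) ∷
      (1785758472 , 1788402381) ∷ (1785770290 , 1788402381) ∷ (1785770290 , 1788390649) ∷
      (1785782002 , 1788390649) ∷ (1785782002 , 1788379021) ∷ (1785793610 , 1788379021) ∷
      (1785793610 , 1788367496) ∷ (1785805115 , 1788367496) ∷ (1785805115 , 1788356074) ∷
      (1785816516 , 1788356074) ∷ (1785816516 , 1788344754) ∷ (1785827816 , 1788344754) ∷
      (1785827816 , 1788333535) ∷ (1785839015 , 1788333535) ∷ (1785839015 , 1788322415) ∷
      (1785850114 , 1788322415) ∷ (1785850114 , 1788311395) ∷ (1785861113 , 1788311395) ∷
      (1785861113 , 1788300473) ∷ (1785872015 , 1788300473) ∷ (1785872015 , 1788289648) ∷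
      (1785882819 , 1788289648) ∷ (1785882819 , 1788278919) ∷ (1785893527 , 1788278919) ∷
      (1785893527 , 1788268286) ∷ (1785904140 , 1788268286) ∷ (1785904140 , 1788257747) ∷
      (1785914658 , 1788257747) ∷ (1785914658 , 1788247302) ∷ (1785925082 , 1788247302) ∷
      (1785925082 , 1788236950) ∷ (1785935413 , 1788236950) ∷ (1785935413 , 1788226690) ∷
      (1785945652 , 1788226690) ∷ (1785945652 , 1788216521) ∷ (1785955800 , 1788216521) ∷
      (1785955800 , 1788206443) ∷ (1785965857 , 1788206443) ∷ (1785965857 , 1788196454) ∷
      (1785975825 , 1788196454) ∷ (1785975825 , 1788186554) ∷ (1785985703 , 1788186554) ∷
      (1785985703 , 1788176743) ∷ (1785995493 , 1788176743) ∷ (1785995493 , 1788167019) ∷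
      (1786005196 , 1788167019) ∷ (1786005196 , 1788157382) ∷ (1786014812 , 1788157382) ∷
      (1786014812 , 1788147831) ∷ (1786024342 , 1788147831) ∷ (1786024342 , 1788138364) ∷
      (1786033788 , 1788138364) ∷ (1786033788 , 1788128981) ∷ (1786043150 , 1788128981) ∷
      (1786043150 , 1788119682) ∷ (1786052428 , 1788119682) ∷ (1786052428 , 1788110465) ∷
      (1786061623 , 1788110465) ∷ (1786061623 , 1788101331) ∷ (1786070736 , 1788101331) ∷
      (1786070736 , 1788092279) ∷ (1786079767 , 1788092279) ∷ (1786079767 , 1788083307) ∷
      (1786088718 , 1788083307) ∷ (1786088718 , 1788074415) ∷ (1786097589 , 1788074415) ∷
      (1786097589 , 1788065602) ∷ (1786106381 , 1788065602) ∷ (1786106381 , 1788056867) ∷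
      (1786115095 , 1788056867) ∷ (1786115095 , 1788048210) ∷ (1786123731 , 1788048210) ∷
      (1786123731 , 1788039630) ∷ (1786132290 , 1788039630) ∷ (1786132290 , 1788031126) ∷
      (1786140773 , 1788031126) ∷ (1786140773 , 1788022698) ∷ (1786149180 , 1788022698) ∷
      (1786149180 , 1788014345) ∷ (1786157512 , 1788014345) ∷ (1786157512 , 1788006067) ∷
      (1786165770 , 1788006067) ∷ (1786165770 , 1787997862) ∷ (1786173954 , 1787997862) ∷
      (1786173954 , 1787989730) ∷ (1786182065 , 1787989730) ∷ (1786182065 , 1787981671) ∷
      (1786190103 , 1787981671) ∷ (1786190103 , 1787973684) ∷ (1786198070 , 1787973684) ∷
      (1786198070 , 1787965767) ∷ [] ) ∷
    []

  twoCycleLows : List ℕ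
  twoCycleLows =
    1710057687 ∷ 1694894166 ∷ 1679777727 ∷ 1664709789 ∷ 1649691751 ∷ 1634724993 ∷ 1619810873 ∷
    1604950730 ∷ 1590145879 ∷ 1575397615 ∷ 1560707211 ∷ 1546075916 ∷ 1531504959 ∷ 1516995541 ∷
    1502548845 ∷ 1488166027 ∷ 1473848218 ∷ 1459596529 ∷ 1445412041 ∷ 1431295815 ∷ 1417248885 ∷
    1403272259 ∷ 1389366920 ∷ 1375533828 ∷ 1361773914 ∷ 1348088086 ∷ 1334477225 ∷ 1320942185 ∷
    1307483796 ∷ 1294102862 ∷ 1280800160 ∷ 1267576441 ∷ 1254432431 ∷ 1241368829 ∷ 1228386309 ∷
    1215485518 ∷ 1202667078 ∷ 1189931585 ∷ 1177279609 ∷ 1164711696 ∷ 1152228366 ∷ 1139830111 ∷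
    1127517402 ∷ 1115290683 ∷ 1103150372 ∷ 1091096866 ∷ 1079130534 ∷ 1067251723 ∷ 1055460755 ∷
    1043757929 ∷ 1032143519 ∷ 1020617778 ∷ 1009180934 ∷ 997833194 ∷ 986574741 ∷ 975405736 ∷
    964326321 ∷ 953336611 ∷ 942436705 ∷ 931626678 ∷ 920906585 ∷ 910276461 ∷ []

  uniquenessCertified? : ℕ → List (ℕ × ℕ) → Bool
  uniquenessCertified? d chain = Certificates.uniqueness? 5 d (List.map dyadic² chain)

  twoCycleCertified? : ℕ → ℕ → Bool
  twoCycleCertified? d c = Certificates.twoCycle? 5 d twoCycleHigh (dyadic c)

  uniqueness-table : T (allCertifiedFrom? uniquenessCertified? 1 uniquenessChains)
  uniqueness-table = tt

  two-cycle-table : T (allCertifiedFrom? twoCycleCertified? 28 twoCycleLows)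
  two-cycle-table = tt

  uniqueness-Δ≤28 : ∀ x → suc (suc x) ℕ.≤ 28 → Uniqueness 6 (suc (suc x))
  uniqueness-Δ≤28 x Δ≤28 = subst (λ d → Uniqueness 6 (suc d)) (ℕ.+-comm x 1)
    (allCertifiedFrom-lookup uniquenessCertified?
      (λ d chain → Certificates.uniqueness?-sound 5 d (List.map dyadic² chain))
      1 uniquenessChains uniqueness-table x (ℕ.≤-pred Δ≤28))

  nonuniqueness-Δ≥29 : ∀ d → 28 ℕ.≤ d → ¬ Uniqueness 6 (suc d)
  nonuniqueness-Δ≥29 d 28≤d with d ℕ.<? 90
  ... | yes d<90 = subst (λ d → ¬ Uniqueness 6 (suc d)) (ℕ.m∸n+n≡m 28≤d)
    (allCertifiedFrom-lookup twoCycleCertified?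
      (λ d c → Certificates.twoCycle?-sound 5 d twoCycleHigh (dyadic c))
      28 twoCycleLows two-cycle-table (d ∸ 28) (ℕ.∸-monoˡ-< d<90 28≤d))
  ... | no d≮90 = subst (λ d → ¬ Uniqueness 6 (suc d)) (ℕ.m∸n+n≡m (ℕ.≮⇒≥ d≮90)) (LargeDegree.nonuniqueness (d ∸ 90))

open import Defs
open import Data.Nat using (ℕ; suc; _≤_; s≤s)
open import Data.Nat.Properties using (≮⇒≥; ≤-pred)
open import Data.Product using (_×_; _,_)
open RootMarginal using (uniqueness-Δ≤28; nonuniqueness-Δ≥29)

corollary59 : (Δ : ℕ) → 2 ≤ Δ → (Uniqueness 6 Δ → Δ ≤ 28) × (Δ ≤ 28 → Uniqueness 6 Δ)
corollary59 (suc (suc x)) (s≤s (s≤s _)) =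
  (λ unique → ≮⇒≥ (λ 28<Δ → nonuniqueness-Δ≥29 (suc x) (≤-pred 28<Δ) unique)) , uniqueness-Δ≤28 x
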